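{- Let $\Lambda=(\lambda^0,\dots,\lambda^{k-1})$ be a $k$-tuple of partitions with $\ell=|\lambda^0|+\dots+|\lambda^{k-1}|\ge1$. The map $\phi:C_{\ell-1}\times\mathrm{SYT\text{ - }tuples}(\Lambda)\to\mathrm{SSYT\text{ - }tuples}(\Lambda)$ defined below is a well-defined bijection, and if $\phi(\alpha,\mathcal T)=\mathfrak T$ then \[ |\alpha|+|\mathrm{DES}(\mathcal T)|+1=\max(\mathfrak T)\quad\text{and}\quad \mathrm{idx}_1(\mathcal T)=\mathrm{idx}_1(\mathfrak T). \]
   Context: $C_{p}$ is the set of $p$-tuples $\alpha=(\alpha_1,\dots,\alpha_p)$ of nonnegative integers, $|\alpha|=\alpha_1+\dots+\alpha_p$. Contents are taken in English notation (column minus row), each cell's content computed within its own diagram. $\mathrm{SYT\text{ - }tuples}(\Lambda)$: bijective fillings of all cells of $\Lambda$ with $1,\dots,\ell$, strictly increasing along rows and columns of each diagram. For $\mathcal T=(T^0,\dots,T^{k-1})$ with $i\in T^s$, $i+1\in T^t$ and $c(j)$ the content of the cell containing $j$: $i$ is a descent if either $s\le t$ and $c(i)>c(i+1)$, or $s>t$ and $c(i)\ge c(i+1)$; $\mathrm{DES}(\mathcal T)$ is the descent set; $\mathrm{idx}_1(\mathcal T)=k-1-s$ where $T^s$ contains $1$. $\mathrm{SSYT\text{ - }tuples}(\Lambda)$: tuples $\mathfrak T=(T^0,\dots,T^{k-1})$ of semistandard Young tableaux ($T^i$ of shape $\lambda^i$, positive integer entries, rows weakly and columns strictly increasing) with at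 least one entry equal to $1$; $\max(\mathfrak T)$ is the largest entry; $\mathrm{idx}_1(\mathfrak T)=k-1-s$ with $s$ the smallest index such that $T^s$ contains $1$. Definition of $\phi$: for $\alpha\in C_{\ell-1}$ and $\mathcal T\in\mathrm{SYT\text{ - }tuples}(\Lambda)$, for $1\le s\le\ell$ let $x_s$ be the cell of $\mathcal T$ containing $s$ and $d_s$ the number of descents of $\mathcal T$ strictly smaller than $s$; $\phi(\alpha,\mathcal T)$ is the tuple obtained by filling each cell $x_s$ with $1+d_s+\sum_{i=1}^{s-1}\alpha_i$. -}

module Defs where

open import Data.Nat as ℕ using (ℕ; zero; suc; _+_; _∸_; _≤_; _<_; _⊔_; _≡ᵇ_; _≤ᵇ_)
open import Data.Integer as ℤ using (ℤ; +_)
open import Data.Integer.Properties as ℤP using ()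
open import Data.Bool using (Bool; true; false; if_then_else_)
open import Data.Maybe using (Maybe; just; nothing)
import Data.Maybe as Maybe
open import Data.Product using (_×_; _,_)
open import Data.Unit using (⊤)
open import Data.Empty using (⊥)
open import Data.Nat.ListAction using (sum)
open import Data.List as List using (List; []; _∷_; length; upTo; concat; filterᵇ; take)
open import Data.List.Relation.Unary.All using (All)
open import Data.List.Membership.Propositional using (_∈_)
open import Data.List.Relation.Binary.Permutation.Propositional using (_↭_)
open import Data.Vec as Vec using (Vec)
import Data.Vec.Relation.Unary.All as VAll
open import Relation.Nullary using (does)
open import Relation.Binary.PropositionalEquality using (_≡_)

Partition : Set
Partition = List ℕ

WeaklyDecreasing : List ℕ → Set
WeaklyDecreasing []           = ⊤
WeaklyDecreasing (x ∷ [])     = ⊤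
WeaklyDecreasing (x ∷ y ∷ xs) = y ≤ x × WeaklyDecreasing (y ∷ xs)

IsPartition : Partition → Set
IsPartition λ′ = All (0 <_) λ′ × WeaklyDecreasing λ′

size : Partition → ℕ
size = sum

totalSize : ∀ {k} → Vec Partition k → ℕ
totalSize Λ = sum (List.map size (Vec.toList Λ))

-- Tableaux: a tableau is its list of rows (English notation, row 0 on top);
-- the cell in row r, column c (both from 0) has content c - r.

Tableau : Set
Tableau = List (List ℕ)

shape : Tableau → Partition
shape = List.map length

entries : Tableau → List ℕ
entries = concat

tupleEntries : ∀ {k} → Vec Tableau k → List ℕ
tupleEntries 𝒯 = concat (List.map entries (Vec.toList 𝒯))

HasShape : ∀ {k} → Vec Partition k → Vec Tableau k → Set
HasShape Λ 𝒯 = Vec.map shape 𝒯 ≡ Λ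

RowStrict : List ℕ → Set
RowStrict []           = ⊤
RowStrict (x ∷ [])     = ⊤
RowStrict (x ∷ y ∷ xs) = x < y × RowStrict (y ∷ xs)

RowWeak : List ℕ → Set
RowWeak []           = ⊤
RowWeak (x ∷ [])     = ⊤
RowWeak (x ∷ y ∷ xs) = x ≤ y × RowWeak (y ∷ xs)

-- row R1 directly above row R2: entries strictly increase down each column
-- (R2 is never longer than R1 in a diagram)
ColStrictPair : List ℕ → List ℕ → Set
ColStrictPair _        []       = ⊤
ColStrictPair []       (_ ∷ _)  = ⊥
ColStrictPair (x ∷ xs) (y ∷ ys) = x < y × ColStrictPair xs ys

ColStrict : Tableau → Set
ColStrict []             = ⊤
ColStrict (R ∷ [])       = ⊤
ColStrict (R ∷ R′ ∷ Rs)  = ColStrictPair R R′ × ColStrict (R′ ∷ Rs)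

StrictTableau : Tableau → Set
StrictTableau T = All RowStrict T × ColStrict T

SemistandardTableau : Tableau → Set
SemistandardTableau T = All RowWeak T × ColStrict T

IsSYTTuple : ∀ {k} → Vec Partition k → Vec Tableau k → Set
IsSYTTuple Λ 𝒯 =
  HasShape Λ 𝒯 × VAll.All StrictTableau 𝒯
  × (tupleEntries 𝒯 ↭ List.map suc (upTo (totalSize Λ)))

IsSSYTTuple : ∀ {k} → Vec Partition k → Vec Tableau k → Set
IsSSYTTuple Λ 𝔗 =
  HasShape Λ 𝔗 × VAll.All SemistandardTableau 𝔗
  × All (1 ≤_) (tupleEntries 𝔗) × (1 ∈ tupleEntries 𝔗)

findRow : ℕ → ℕ → List ℕ → Maybe ℕ
findRow v c []       = nothing
findRow v c (x ∷ xs) = if x ≡ᵇ v then just c else findRow v (suc c) xs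

findTab : ℕ → ℕ → Tableau → Maybe ℤ
findTab v r []       = nothing
findTab v r (R ∷ Rs) with findRow v 0 R
... | just c  = just (+ c ℤ.- + r)
... | nothing = findTab v (suc r) Rs

findTup : ℕ → ℕ → List Tableau → Maybe (ℕ × ℤ)
findTup v s []       = nothing
findTup v s (T ∷ Ts) with findTab v 0 T
... | just c  = just (s , c)
... | nothing = findTup v (suc s) Ts

locate : ∀ {k} → Vec Tableau k → ℕ → Maybe (ℕ × ℤ)
locate 𝒯 v = findTup v 0 (Vec.toList 𝒯)

isDescent : ∀ {k} → Vec Tableau k → ℕ → Bool
isDescent 𝒯 i with locate 𝒯 i | locate 𝒯 (suc i)
... | just (s , ci) | just (t , ci+1) =
      if s ≤ᵇ t then does (ci+1 ℤP.<? ci) else does (ci+1 ℤP.≤? ci)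
... | _ | _ = false

descentsUpTo : ∀ {k} → Vec Tableau k → ℕ → List ℕ
descentsUpTo 𝒯 n = filterᵇ (isDescent 𝒯) (List.map suc (upTo n))

DES : ∀ {k} → Vec Partition k → Vec Tableau k → List ℕ
DES Λ 𝒯 = descentsUpTo 𝒯 (totalSize Λ ∸ 1)

dBelow : ∀ {k} → Vec Tableau k → ℕ → ℕ
dBelow 𝒯 s = length (descentsUpTo 𝒯 (s ∸ 1))

idx₁ : ∀ {k} → Vec Tableau k → Maybe ℕ
idx₁ {k} 𝒯 = Maybe.map (λ { (s , _) → k ∸ 1 ∸ s }) (locate 𝒯 1)

maxEntry : ∀ {k} → Vec Tableau k → ℕ
maxEntry 𝔗 = List.foldr _⊔_ 0 (tupleEntries 𝔗)

∣_∣ : ∀ {n} → Vec ℕ n → ℕ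
∣ α ∣ = Vec.sum α

φ : ∀ {k n} → Vec ℕ n → Vec Tableau k → Vec Tableau k
φ α 𝒯 = Vec.map (List.map (List.map f)) 𝒯
  where
  f : ℕ → ℕ
  f s = 1 + dBelow 𝒯 s + sum (take (s ∸ 1) (Vec.toList α))

-- Let f(s) = 1 + d_s + α_1 + ⋯ + α_{s-1} be the entry φ gives to the cell of s. It is weakly increasing in s
-- and strictly increasing across every descent, so if two cells of 𝒯 receive the same entry there is no descent
-- between them, and then the later one lies weakly later in the order "content first, then component". As the
-- content drops down a column, φ(α, 𝒯) is semistandard, and ranking the cells of φ(α, 𝒯) by (entry, content,
-- component) recovers 𝒯, which gives injectivity. Conversely this standardisation of a semistandard tuple 𝔗 is
-- standard, cells of consecutive rank carry entries differing at least by the descent indicator, and α is read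
-- off from the remaining increments, so φ is onto. Finally f(ℓ) = 1 + |DES| + |α| is the largest entry; and 1
-- sits in a corner of 𝒯, while a component of φ(α, 𝒯) containing 1 has a 1 in its corner too, which by the
-- argument above comes weakly after the component of 1 in 𝒯.

module Submission where

open import Defs
open import Data.Nat.Base
  using (ℕ; zero; suc; pred; _+_; _∸_; _≤_; _<_; _⊔_; _⊓_; _≡ᵇ_; _≤ᵇ_; z≤n; s≤s; _≤′_; ≤′-refl; ≤′-step; >-nonZero)
import Data.Nat.Properties as ℕ
open import Data.Nat.ListAction using (sum)
import Data.Nat.Tactic.RingSolver as ℕ-Solver
open import Data.Integer.Base as ℤ using (ℤ; +_; +<+)
import Data.Integer.Properties as ℤ
open import Data.Integer.Tactic.RingSolver using (solve-∀)
open import Data.Bool.Base using (true; false; T; if_then_else_)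
open import Data.Maybe.Base using (Maybe; just; nothing; maybe)
open import Data.List.Base using (List; []; _∷_; _++_; [_]; length; map; concat; foldr; filter; find; upTo; take)
import Data.List.Properties as List
open import Data.List.Relation.Unary.All as All using (All; []; _∷_)
import Data.List.Relation.Unary.All.Properties as All
open import Data.List.Relation.Unary.Any using (here; there)
import Data.List.Relation.Unary.AllPairs as AllPairs
open import Data.List.Relation.Unary.Unique.Propositional using (Unique; []; _∷_)
import Data.List.Relation.Unary.Unique.Propositional.Properties as Unique
open import Data.List.Membership.Propositional using (_∈_)
import Data.List.Membership.Propositional.Properties as ∈
open import Data.List.Relation.Binary.Permutation.Propositional
  using (_↭_; ↭-sym; ↭-prep; ↭⇒↭ₛ; module PermutationReasoning)
import Data.List.Relation.Binary.Permutation.Propositional.Properties as ↭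
import Data.List.Relation.Binary.Permutation.Setoid.Properties as ↭ₛ
open import Data.Vec.Base as Vec using (Vec; []; _∷_)
import Data.Vec.Properties as Vec
import Data.Vec.Relation.Unary.All as VAll
open import Data.Product.Base using (_×_; _,_; proj₁; proj₂; ∃-syntax; Σ; uncurry; map₁)
open import Data.Product.Properties using (,-injectiveˡ; ,-injectiveʳ)
open import Data.Product.Relation.Binary.Lex.Strict using (×-Lex; ×-transitive; ×-compare)
open import Data.Product.Relation.Binary.Pointwise.NonDependent using (≡×≡⇒≡; ≡⇒≡×≡)
open import Data.Sum.Base using (_⊎_; inj₁; inj₂; [_,_]′)
import Data.Sum.Base as Sum
open import Data.Unit.Base using (tt)
open import Function.Base using (_∘_)
open import Level using (0ℓ)
open import Relation.Nullary using (¬_; Dec; yes; no; does; contradiction)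
open import Relation.Nullary.Decidable.Core using (T?)
open import Relation.Unary using (Pred; Decidable; ∁)
open import Relation.Binary.Core using (Rel)
open import Relation.Binary.Definitions using (Transitive; Trichotomous; tri<; tri≈; tri>)
open import Relation.Binary.Structures using (IsStrictTotalOrder)
open import Relation.Binary.Structures.Biased using (isStrictTotalOrderᶜ)
open import Relation.Binary.PropositionalEquality
  using (_≡_; _≢_; refl; sym; trans; cong; cong₂; subst; subst₂; isEquivalence; resp₂; setoid; module ≡-Reasoning)

count : ∀ {A : Set} {P : Pred A 0ℓ} → Decidable P → List A → ℕ
count P? xs = length (filter P? xs)

module _ {A : Set} {P : Pred A 0ℓ} (P? : Decidable P) where

  count-++ : ∀ xs ys → count P? (xs ++ ys) ≡ count P? xs + count P? ys
  count-++ xs ys = trans (cong length (List.filter-++ P? xs ys)) (List.length-++ (filter P? xs))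

  count-↭ : ∀ {xs ys} → xs ↭ ys → count P? xs ≡ count P? ys
  count-↭ xs↭ys = ↭.↭-length (↭.filter-↭ P? xs↭ys)

  count-none : ∀ {xs} → All (∁ P) xs → count P? xs ≡ 0
  count-none = cong length ∘ List.filter-none P?

  count-map : ∀ {B : Set} (f : B → A) xs → count P? (map f xs) ≡ count (P? ∘ f) xs
  count-map f []       = refl
  count-map f (x ∷ xs) with does (P? (f x))
  ... | true  = cong suc (count-map f xs)
  ... | false = count-map f xs

module _ {A : Set} {P Q : Pred A 0ℓ} (P? : Decidable P) (Q? : Decidable Q) where

  count-mono : ∀ {xs} → (∀ {x} → x ∈ xs → P x → Q x) → count P? xs ≤ count Q? xs
  count-mono {[]}     P⇒Q = z≤n
  count-mono {x ∷ xs} P⇒Q with P? x | Q? x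
  ... | yes _  | yes _ = s≤s (count-mono (P⇒Q ∘ there))
  ... | yes px | no ¬q = contradiction (P⇒Q (here refl) px) ¬q
  ... | no _   | yes _ = ℕ.m≤n⇒m≤1+n (count-mono (P⇒Q ∘ there))
  ... | no _   | no _  = count-mono (P⇒Q ∘ there)

  count-mono-< : ∀ {xs y} → (∀ {x} → x ∈ xs → P x → Q x) → y ∈ xs → ¬ P y → Q y →
                 count P? xs < count Q? xs
  count-mono-< {x ∷ xs} P⇒Q y∈ ¬py qy with P? x | Q? x
  count-mono-< {x ∷ xs} P⇒Q (here refl) ¬py qy | yes py | _ = contradiction py ¬py
  count-mono-< {x ∷ xs} P⇒Q (here refl) ¬py qy | no _ | yes _ = s≤s (count-mono (P⇒Q ∘ there))
  count-mono-< {x ∷ xs} P⇒Q (here refl) ¬py qy | no _ | no ¬qy = contradiction qy ¬qy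
  count-mono-< {x ∷ xs} P⇒Q (there y∈) ¬py qy | yes _  | yes _ = s≤s (count-mono-< (P⇒Q ∘ there) y∈ ¬py qy)
  count-mono-< {x ∷ xs} P⇒Q (there y∈) ¬py qy | yes px | no ¬q = contradiction (P⇒Q (here refl) px) ¬q
  count-mono-< {x ∷ xs} P⇒Q (there y∈) ¬py qy | no _   | yes _ = ℕ.m≤n⇒m≤1+n (count-mono-< (P⇒Q ∘ there) y∈ ¬py qy)
  count-mono-< {x ∷ xs} P⇒Q (there y∈) ¬py qy | no _   | no _  = count-mono-< (P⇒Q ∘ there) y∈ ¬py qy

count-cong : ∀ {A : Set} {P Q : Pred A 0ℓ} (P? : Decidable P) (Q? : Decidable Q) {xs} →
             (∀ {x} → x ∈ xs → P x → Q x) → (∀ {x} → x ∈ xs → Q x → P x) →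
             count P? xs ≡ count Q? xs
count-cong P? Q? P⇒Q Q⇒P = ℕ.≤-antisym (count-mono P? Q? P⇒Q) (count-mono Q? P? Q⇒P)

oneTo : ℕ → List ℕ
oneTo n = map suc (upTo n)

oneTo-∷ʳ : ∀ n → oneTo (suc n) ≡ oneTo n ++ [ suc n ]
oneTo-∷ʳ n = trans (cong (map suc) (sym (List.upTo-∷ʳ n))) (List.map-++ suc (upTo n) [ n ])

oneTo-suc : ∀ n → oneTo (suc n) ≡ 1 ∷ map suc (oneTo n)
oneTo-suc n = cong (λ xs → 1 ∷ map suc xs) (sym (List.map-upTo suc n))

∈oneTo⁺ : ∀ {n a} → 1 ≤ a → a ≤ n → a ∈ oneTo n
∈oneTo⁺ {a = suc a} (s≤s _) a≤n = ∈.∈-map⁺ suc (∈.∈-upTo⁺ a≤n)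

∈oneTo⁻ : ∀ {n a} → a ∈ oneTo n → 1 ≤ a × a ≤ n
∈oneTo⁻ a∈ with b , b∈ , refl ← ∈.∈-map⁻ suc a∈ = s≤s z≤n , ∈.∈-upTo⁻ b∈

oneTo-unique : ∀ n → Unique (oneTo n)
oneTo-unique n = Unique.map⁺ ℕ.suc-injective (Unique.upTo⁺ n)

count-<-oneTo : ∀ a n → count (ℕ._<? a) (oneTo n) ≡ (a ∸ 1) ⊓ n
count-<-oneTo a zero    = sym (ℕ.⊓-zeroʳ (a ∸ 1))
count-<-oneTo a (suc n) = begin
  count (ℕ._<? a) (oneTo (suc n))                     ≡⟨ cong (count (ℕ._<? a)) (oneTo-∷ʳ n) ⟩
  count (ℕ._<? a) (oneTo n ++ [ suc n ])              ≡⟨ count-++ (ℕ._<? a) (oneTo n) [ suc n ] ⟩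
  count (ℕ._<? a) (oneTo n) + count (ℕ._<? a) [ suc n ] ≡⟨ cong (_+ count (ℕ._<? a) [ suc n ]) (count-<-oneTo a n) ⟩
  (a ∸ 1) ⊓ n + count (ℕ._<? a) [ suc n ]             ≡⟨ last a ⟩
  (a ∸ 1) ⊓ suc n                                     ∎
  where
  open ≡-Reasoning
  last : ∀ a → (a ∸ 1) ⊓ n + count (ℕ._<? a) [ suc n ] ≡ (a ∸ 1) ⊓ suc n
  last zero = refl
  last (suc a) with suc n ℕ.<? suc a
  ... | yes sn<sa@(s≤s n<a) = begin
    a ⊓ n + count (ℕ._<? suc a) [ suc n ] ≡⟨ cong (λ ys → a ⊓ n + length ys) (List.filter-accept (ℕ._<? suc a) sn<sa) ⟩
    a ⊓ n + 1                             ≡⟨ cong (_+ 1) (ℕ.m≥n⇒m⊓n≡n (ℕ.<⇒≤ n<a)) ⟩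
    n + 1                                 ≡⟨ ℕ.+-comm n 1 ⟩
    suc n                                 ≡⟨ ℕ.m≥n⇒m⊓n≡n n<a ⟨
    a ⊓ suc n                             ∎
  ... | no sn≮sa = begin
    a ⊓ n + count (ℕ._<? suc a) [ suc n ] ≡⟨ cong (λ ys → a ⊓ n + length ys) (List.filter-reject (ℕ._<? suc a) sn≮sa) ⟩
    a ⊓ n + 0                             ≡⟨ ℕ.+-identityʳ _ ⟩
    a ⊓ n                                 ≡⟨ ℕ.m≤n⇒m⊓n≡m a≤n ⟩
    a                                     ≡⟨ ℕ.m≤n⇒m⊓n≡m (ℕ.m≤n⇒m≤1+n a≤n) ⟨
    a ⊓ suc n                             ∎
    where a≤n = ℕ.≤-pred (ℕ.≮⇒≥ sn≮sa)

count-<-↭oneTo : ∀ {xs n a} → xs ↭ oneTo n → a ≤ n → count (ℕ._<? a) xs ≡ a ∸ 1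
count-<-↭oneTo {xs} {n} {a} xs↭ a≤n = begin
  count (ℕ._<? a) xs     ≡⟨ count-↭ (ℕ._<? a) xs↭ ⟩
  count (ℕ._<? a) (oneTo n) ≡⟨ count-<-oneTo a n ⟩
  (a ∸ 1) ⊓ n            ≡⟨ ℕ.m≤n⇒m⊓n≡m (ℕ.≤-trans (ℕ.m∸n≤m a 1) a≤n) ⟩
  a ∸ 1                  ∎
  where open ≡-Reasoning

foldr-⊔-≡ : ∀ {m xs} → m ∈ xs → All (_≤ m) xs → foldr _⊔_ 0 xs ≡ m
foldr-⊔-≡ {xs = x ∷ xs} (here refl) (_ ∷ xs≤m)   = ℕ.m≥n⇒m⊔n≡m (foldr-⊔-≤ xs≤m)
  where
  foldr-⊔-≤ : ∀ {m ys} → All (_≤ m) ys → foldr _⊔_ 0 ys ≤ m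
  foldr-⊔-≤ []           = z≤n
  foldr-⊔-≤ (y≤m ∷ ys≤m) = ℕ.⊔-lub y≤m (foldr-⊔-≤ ys≤m)
foldr-⊔-≡ {xs = x ∷ xs} (there m∈) (x≤m ∷ xs≤m) =
  trans (cong (x ⊔_) (foldr-⊔-≡ m∈ xs≤m)) (ℕ.m≤n⇒m⊔n≡n x≤m)

find-≡ : ∀ {A : Set} {P : Pred A 0ℓ} (P? : Decidable P) {xs x} →
         x ∈ xs → P x → (∀ {y} → y ∈ xs → P y → y ≡ x) → find P? xs ≡ just x
find-≡ P? {y ∷ xs} x∈ px unique with P? y
... | yes py = cong just (unique (here refl) py)
find-≡ P? {y ∷ xs} (here refl) px unique | no ¬py = contradiction px ¬py
find-≡ P? {y ∷ xs} (there x∈)  px unique | no _   = find-≡ P? x∈ px (unique ∘ there)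

Unique-resp-↭ : ∀ {A : Set} {xs ys : List A} → xs ↭ ys → Unique xs → Unique ys
Unique-resp-↭ {A} xs↭ys = ↭ₛ.Unique-resp-↭ (setoid A) (↭⇒↭ₛ xs↭ys)

module _ {A B : Set} {f : A → B} where

  Unique-map⁺-∈ : ∀ {xs} → (∀ {a b} → a ∈ xs → b ∈ xs → f a ≡ f b → a ≡ b) →
                  Unique xs → Unique (map f xs)
  Unique-map⁺-∈ {[]}     inj []             = []
  Unique-map⁺-∈ {x ∷ xs} inj (x∉xs ∷ uniq) =
    All.map⁺ (All.tabulate λ b∈ fx≡fb → All.lookup x∉xs b∈ (inj (here refl) (there b∈) fx≡fb))
    ∷ Unique-map⁺-∈ (λ a∈ b∈ → inj (there a∈) (there b∈)) uniq

  Unique-map⁻-∈ : ∀ {xs a b} → Unique (map f xs) → a ∈ xs → b ∈ xs → f a ≡ f b → a ≡ b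
  Unique-map⁻-∈ {x ∷ xs} (_ ∷ uniq) (here refl) (here refl) _ = refl
  Unique-map⁻-∈ {x ∷ xs} (fx∉ ∷ _) (here refl) (there b∈) fa≡fb =
    contradiction fa≡fb (All.lookup (All.map⁻ fx∉) b∈)
  Unique-map⁻-∈ {x ∷ xs} (fx∉ ∷ _) (there a∈) (here refl) fa≡fb =
    contradiction (sym fa≡fb) (All.lookup (All.map⁻ fx∉) a∈)
  Unique-map⁻-∈ {x ∷ xs} (_ ∷ uniq) (there a∈) (there b∈) fa≡fb = Unique-map⁻-∈ uniq a∈ b∈ fa≡fb

×-Lex-isStrictTotalOrder : ∀ {A B : Set} {_<₁_ : Rel A 0ℓ} {_<₂_ : Rel B 0ℓ} →
  IsStrictTotalOrder _≡_ _<₁_ → IsStrictTotalOrder _≡_ _<₂_ →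
  IsStrictTotalOrder _≡_ (×-Lex _≡_ _<₁_ _<₂_)
×-Lex-isStrictTotalOrder {_<₁_ = _<₁_} {_<₂_} o₁ o₂ = isStrictTotalOrderᶜ record
  { isEquivalence = isEquivalence
  ; trans         = ×-transitive {_<₂_ = _<₂_} isEquivalence (resp₂ _<₁_) O₁.trans O₂.trans
  ; compare       = compare
  }
  where
  module O₁ = IsStrictTotalOrder o₁
  module O₂ = IsStrictTotalOrder o₂
  compare : Trichotomous _≡_ (×-Lex _≡_ _<₁_ _<₂_)
  compare a b with ×-compare sym O₁.compare O₂.compare a b
  ... | tri< a<b a≉b a≯b = tri< a<b (a≉b ∘ ≡⇒≡×≡) a≯b
  ... | tri≈ a≮b a≈b a≯b = tri≈ a≮b (≡×≡⇒≡ a≈b) a≯b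
  ... | tri> a≮b a≉b a>b = tri> a≮b (a≉b ∘ ≡⇒≡×≡) a>b

module Rank {K : Set} {_≺_ : Rel K 0ℓ} (sto : IsStrictTotalOrder _≡_ _≺_) where
  open IsStrictTotalOrder sto using (irrefl; compare) renaming (_<?_ to _≺?_; trans to ≺-trans)

  rank : List K → K → ℕ
  rank ks k = suc (count (_≺? k) ks)

  rank-mono : ∀ {ks a b} → a ∈ ks → a ≺ b → rank ks a < rank ks b
  rank-mono {a = a} {b} a∈ a≺b = s≤s (count-mono-< (_≺? a) (_≺? b) (λ _ c≺a → ≺-trans c≺a a≺b) a∈ (irrefl refl) a≺b)

  rank-injective : ∀ {ks a b} → a ∈ ks → b ∈ ks → rank ks a ≡ rank ks b → a ≡ b
  rank-injective a∈ b∈ eq with compare _ _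
  ... | tri< a≺b _ _ = contradiction eq (ℕ.<⇒≢ (rank-mono a∈ a≺b))
  ... | tri≈ _ a≡b _ = a≡b
  ... | tri> _ _ b≺a = contradiction (sym eq) (ℕ.<⇒≢ (rank-mono b∈ b≺a))

  rank-cancel-≺ : ∀ {ks a b} → b ∈ ks → rank ks a < rank ks b → a ≺ b
  rank-cancel-≺ b∈ r<r with compare _ _
  ... | tri< a≺b _ _ = a≺b
  ... | tri≈ _ refl _ = contradiction r<r (ℕ.<-irrefl refl)
  ... | tri> _ _ b≺a = contradiction (rank-mono b∈ b≺a) (ℕ.<-asym r<r)

  unrank : List K → ℕ → Maybe K
  unrank ks s = find (λ k → rank ks k ℕ.≟ s) ks

  unrank-rank : ∀ {ks k} → k ∈ ks → unrank ks (rank ks k) ≡ just k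
  unrank-rank k∈ = find-≡ _ k∈ refl (λ y∈ eq → rank-injective y∈ k∈ eq)

  minimum : ∀ k ks → ∃[ m ] m ∈ k ∷ ks × All (λ b → ¬ b ≺ m) (k ∷ ks)
  minimum k [] = k , here refl , irrefl refl ∷ []
  minimum k (k′ ∷ ks) with minimum k′ ks
  ... | m , m∈ , m-min with k ≺? m
  ...   | yes k≺m = k , here refl , irrefl refl ∷ All.map (λ b⊀m b≺k → b⊀m (≺-trans b≺k k≺m)) m-min
  ...   | no k⊀m  = m , there m∈ , k⊀m ∷ m-min

  -- induction on the length, removing a minimal element
  ranks-↭ : ∀ n {ks} → length ks ≡ n → Unique ks → map (rank ks) ks ↭ oneTo n
  ranks-↭ zero    {[]}     _   _    = _↭_.refl
  ranks-↭ (suc n) {k ∷ ks} len uniq with minimum k ks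
  ... | m , m∈ , m-min with ys , zs , Q≡ ← ∈.∈-∃++ m∈ = begin
    map (rank Q) Q                ↭⟨ ↭.map⁺ (rank Q) Q↭ ⟩
    rank Q m ∷ map (rank Q) R     ≡⟨ cong₂ _∷_ rank-m (List.map-cong-local (All.tabulate rank-R)) ⟩
    1 ∷ map (suc ∘ rank R) R      ≡⟨ cong (1 ∷_) (List.map-∘ R) ⟩
    1 ∷ map suc (map (rank R) R)  ↭⟨ ↭-prep 1 (↭.map⁺ suc (ranks-↭ n lenR uniqR)) ⟩
    1 ∷ map suc (oneTo n)         ≡⟨ oneTo-suc n ⟨
    oneTo (suc n)                 ∎
    where
    open PermutationReasoning
    Q R : List K
    Q = k ∷ ks
    R = ys ++ zs
    Q↭ : Q ↭ m ∷ R
    Q↭ = subst (_↭ m ∷ R) (sym Q≡) (↭.shift m ys zs)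
    m∷R-unique : Unique (m ∷ R)
    m∷R-unique = Unique-resp-↭ Q↭ uniq
    uniqR : Unique R
    uniqR = AllPairs.tail m∷R-unique
    lenR : length R ≡ n
    lenR = ℕ.suc-injective (trans (sym (↭.↭-length Q↭)) len)
    minimal : ∀ {b} → b ∈ m ∷ R → ¬ b ≺ m
    minimal b∈ = All.lookup m-min (↭.∈-resp-↭ (↭-sym Q↭) b∈)
    rank-m : rank Q m ≡ 1
    rank-m = cong suc (trans (count-↭ (_≺? m) Q↭) (count-none (_≺? m) (All.tabulate minimal)))
    m≺R : ∀ {b} → b ∈ R → m ≺ b
    m≺R {b} b∈ with compare m b
    ... | tri< m≺b _ _  = m≺b
    ... | tri≈ _ m≡b _  = contradiction m≡b (All.lookup (AllPairs.head m∷R-unique) b∈)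
    ... | tri> _ _ b≺m  = contradiction b≺m (minimal (there b∈))
    rank-R : ∀ {b} → b ∈ R → rank Q b ≡ suc (rank R b)
    rank-R {b} b∈ = cong suc (trans (count-↭ (_≺? b) Q↭) (cong length (List.filter-accept (_≺? b) (m≺R b∈))))

-- Cells of tuples of tableaux

-- (component, row, column), each counted from 0
Cell : Set
Cell = ℕ × ℕ × ℕ

right below nextComponent : Cell → Cell
right (j , r , c) = j , r , suc c
below (j , r , c) = j , suc r , c
nextComponent (j , r , c) = suc j , r , c

nextComponent-injective : ∀ {x y} → nextComponent x ≡ nextComponent y → x ≡ y
nextComponent-injective {_ , _} {_ , _} refl = refl

content : Cell → ℤ
content (_ , r , c) = + c ℤ.- + r

module _ {A : Set} where

  data AtRow : List A → ℕ → A → Set where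
    here  : ∀ {x xs} → AtRow (x ∷ xs) 0 x
    there : ∀ {y xs c x} → AtRow xs c x → AtRow (y ∷ xs) (suc c) x

  data AtTableau : List (List A) → ℕ → ℕ → A → Set where
    here  : ∀ {R Rs c x} → AtRow R c x → AtTableau (R ∷ Rs) 0 c x
    there : ∀ {R Rs r c x} → AtTableau Rs r c x → AtTableau (R ∷ Rs) (suc r) c x

  infix 4 _[_]=_
  data _[_]=_ : ∀ {k} → Vec (List (List A)) k → Cell → A → Set where
    here  : ∀ {k T r c x} {𝒯 : Vec _ k} → AtTableau T r c x → (T ∷ 𝒯) [ 0 , r , c ]= x
    there : ∀ {k T j r c x} {𝒯 : Vec _ k} → 𝒯 [ j , r , c ]= x → (T ∷ 𝒯) [ suc j , r , c ]= x

  -- for tuples of tableaux this is tupleEntries, definitionally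
  flatten : ∀ {k} → Vec (List (List A)) k → List A
  flatten 𝒯 = concat (map concat (Vec.toList 𝒯))

  []=-functional : ∀ {k} {𝒯 : Vec _ k} {x v w} → 𝒯 [ x ]= v → 𝒯 [ x ]= w → v ≡ w
  []=-functional (here p)  (here q)  = tableau p q
    where
    row : ∀ {R c v w} → AtRow R c v → AtRow R c w → v ≡ w
    row here      here      = refl
    row (there p) (there q) = row p q
    tableau : ∀ {T r c v w} → AtTableau T r c v → AtTableau T r c w → v ≡ w
    tableau (here p)  (here q)  = row p q
    tableau (there p) (there q) = tableau p q
  []=-functional (there p) (there q) = []=-functional p q

  []=⇒∈flatten : ∀ {k} {𝒯 : Vec _ k} {x v} → 𝒯 [ x ]= v → v ∈ flatten 𝒯
  []=⇒∈flatten (here p)  = ∈.∈-++⁺ˡ (tableau p)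
    where
    row : ∀ {R c v} → AtRow R c v → v ∈ R
    row here      = here refl
    row (there p) = there (row p)
    tableau : ∀ {T r c v} → AtTableau T r c v → v ∈ concat T
    tableau (here p)            = ∈.∈-++⁺ˡ (row p)
    tableau (there {R = R} p) = ∈.∈-++⁺ʳ R (tableau p)
  []=⇒∈flatten {𝒯 = T ∷ _} (there p) = ∈.∈-++⁺ʳ (concat T) ([]=⇒∈flatten p)

-- relabelling shifts the position argument instead of carrying offsets
module _ {A B : Set} where

  relabelRow : (ℕ → A → B) → List A → List B
  relabelRow h []       = []
  relabelRow h (x ∷ xs) = h 0 x ∷ relabelRow (h ∘ suc) xs

  relabelTableau : (ℕ → ℕ → A → B) → List (List A) → List (List B)
  relabelTableau h []       = []
  relabelTableau h (R ∷ Rs) = relabelRow (h 0) R ∷ relabelTableau (h ∘ suc) Rs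

  relabel : ∀ {k} → (Cell → A → B) → Vec (List (List A)) k → Vec (List (List B)) k
  relabel h []      = []
  relabel h (T ∷ 𝒯) = relabelTableau (λ r c → h (0 , r , c)) T ∷ relabel (h ∘ nextComponent) 𝒯

  relabel-[]=⁺ : ∀ {k} {h : Cell → A → B} {𝒯 : Vec _ k} {x v} → 𝒯 [ x ]= v → relabel h 𝒯 [ x ]= h x v
  relabel-[]=⁺ (here p)  = here (tableau p)
    where
    row : ∀ {h : ℕ → A → B} {R c v} → AtRow R c v → AtRow (relabelRow h R) c (h c v)
    row here      = here
    row (there p) = there (row p)
    tableau : ∀ {h : ℕ → ℕ → A → B} {T r c v} → AtTableau T r c v → AtTableau (relabelTableau h T) r c (h r c v)
    tableau (here p)  = here (row p)
    tableau (there p) = there (tableau p)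
  relabel-[]=⁺ (there p) = there (relabel-[]=⁺ p)

  relabel-[]=⁻ : ∀ {k} {h : Cell → A → B} {𝒯 : Vec _ k} {x w} → relabel h 𝒯 [ x ]= w →
                 ∃[ v ] 𝒯 [ x ]= v × w ≡ h x v
  relabel-[]=⁻ {𝒯 = T ∷ _} (here p) = let v , q , w≡ = tableau T p in v , here q , w≡
    where
    row : ∀ {h : ℕ → A → B} R {c w} → AtRow (relabelRow h R) c w → ∃[ v ] AtRow R c v × w ≡ h c v
    row (x ∷ R) here      = x , here , refl
    row (x ∷ R) (there p) = let v , q , w≡ = row R p in v , there q , w≡
    tableau : ∀ {h : ℕ → ℕ → A → B} T {r c w} → AtTableau (relabelTableau h T) r c w →
              ∃[ v ] AtTableau T r c v × w ≡ h r c v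
    tableau (R ∷ T) (here p)  = let v , q , w≡ = row R p in v , here q , w≡
    tableau (R ∷ T) (there p) = let v , q , w≡ = tableau T p in v , there q , w≡
  relabel-[]=⁻ {𝒯 = T ∷ 𝒯} (there p) = let v , q , w≡ = relabel-[]=⁻ p in v , there q , w≡

  ∈relabelRow⁻ : ∀ {h : ℕ → A → B} {R w} → w ∈ relabelRow h R → ∃[ c ] ∃[ v ] AtRow R c v × w ≡ h c v
  ∈relabelRow⁻ {R = x ∷ R} (here refl) = 0 , x , here , refl
  ∈relabelRow⁻ {R = x ∷ R} (there w∈) = let c , v , p , w≡ = ∈relabelRow⁻ w∈ in suc c , v , there p , w≡

  ∈relabelTableau⁻ : ∀ {h : ℕ → ℕ → A → B} {T w} → w ∈ concat (relabelTableau h T) →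
                     ∃[ r ] ∃[ c ] ∃[ v ] AtTableau T r c v × w ≡ h r c v
  ∈relabelTableau⁻ {h = h} {R ∷ T} w∈ with ∈.∈-++⁻ (relabelRow (h 0) R) w∈
  ... | inj₁ w∈R = let c , v , p , w≡ = ∈relabelRow⁻ w∈R in 0 , c , v , here p , w≡
  ... | inj₂ w∈T = let r , c , v , p , w≡ = ∈relabelTableau⁻ w∈T in suc r , c , v , there p , w≡

  ∈relabel⁻ : ∀ {k} {h : Cell → A → B} {𝒯 : Vec _ k} {w} → w ∈ flatten (relabel h 𝒯) →
              ∃[ x ] ∃[ v ] 𝒯 [ x ]= v × w ≡ h x v
  ∈relabel⁻ {h = h} {T ∷ 𝒯} w∈ with ∈.∈-++⁻ (concat (relabelTableau (λ r c → h (0 , r , c)) T)) w∈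
  ... | inj₁ w∈T = let r , c , v , p , w≡ = ∈relabelTableau⁻ w∈T in (0 , r , c) , v , here p , w≡
  ... | inj₂ w∈𝒯 = let (j , r , c) , v , p , w≡ = ∈relabel⁻ w∈𝒯 in (suc j , r , c) , v , there p , w≡

  relabel-unique : ∀ {k} {h : Cell → A → B} {𝒯 : Vec _ k} →
                   (∀ {x y v w} → h x v ≡ h y w → x ≡ y) → Unique (flatten (relabel h 𝒯))
  relabel-unique {𝒯 = []}    inj = []
  relabel-unique {h = h} {𝒯 = T ∷ 𝒯} inj =
    Unique.++⁺ (tableau T (λ e → ,-injectiveʳ (inj e)))
               (relabel-unique {h = h ∘ nextComponent} {𝒯 = 𝒯} (λ e → nextComponent-injective (inj e)))
               disjoint
    where
    disjoint : ∀ {w} → ¬ (w ∈ concat (relabelTableau (λ r c → h (0 , r , c)) T) × w ∈ flatten (relabel (h ∘ nextComponent) 𝒯))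
    disjoint (w∈T , w∈𝒯) with ∈relabelTableau⁻ {T = T} w∈T | ∈relabel⁻ {h = h ∘ nextComponent} {𝒯 = 𝒯} w∈𝒯
    ... | _ , _ , _ , _ , w≡ | _ , _ , _ , w≡′ = ℕ.0≢1+n (,-injectiveˡ (inj (trans (sym w≡) w≡′)))
    row : ∀ {h : ℕ → A → B} R → (∀ {c c′ v w} → h c v ≡ h c′ w → c ≡ c′) → Unique (relabelRow h R)
    row []          inj = []
    row {h} (x ∷ R) inj = All.tabulate head-fresh ∷ row R (λ e → ℕ.suc-injective (inj e))
      where
      head-fresh : ∀ {w} → w ∈ relabelRow (h ∘ suc) R → h 0 x ≢ w
      head-fresh w∈ e with ∈relabelRow⁻ {h = h ∘ suc} w∈
      ... | _ , _ , _ , w≡ = ℕ.0≢1+n (inj (trans e w≡))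
    tableau : ∀ {h : ℕ → ℕ → A → B} T → (∀ {r c r′ c′ v w} → h r c v ≡ h r′ c′ w → (r , c) ≡ (r′ , c′)) →
              Unique (concat (relabelTableau h T))
    tableau []          inj = []
    tableau {h} (R ∷ T) inj =
      Unique.++⁺ (row R (λ e → ,-injectiveʳ (inj e))) (tableau T (λ e → cong (map₁ pred) (inj e))) disjoint-rows
      where
      disjoint-rows : ∀ {w} → ¬ (w ∈ relabelRow (h 0) R × w ∈ concat (relabelTableau (h ∘ suc) T))
      disjoint-rows (w∈R , w∈T) with ∈relabelRow⁻ {h = h 0} w∈R | ∈relabelTableau⁻ {h = h ∘ suc} {T} w∈T
      ... | _ , _ , _ , w≡ | _ , _ , _ , _ , w≡′ = ℕ.0≢1+n (,-injectiveˡ (inj (trans (sym w≡) w≡′)))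

mapEntries : ∀ {A B : Set} {k} → (A → B) → Vec (List (List A)) k → Vec (List (List B)) k
mapEntries f = Vec.map (map (map f))

module _ {A B C : Set} where

  relabel-relabel : ∀ {k} (g : Cell → B → C) (h : Cell → A → B) (𝒯 : Vec _ k) →
                    relabel g (relabel h 𝒯) ≡ relabel (λ x v → g x (h x v)) 𝒯
  relabel-relabel g h []      = refl
  relabel-relabel g h (T ∷ 𝒯) =
    cong₂ _∷_ (tableau (λ r c → g (0 , r , c)) (λ r c → h (0 , r , c)) T) (relabel-relabel (g ∘ nextComponent) (h ∘ nextComponent) 𝒯)
    where
    row : ∀ (g : ℕ → B → C) (h : ℕ → A → B) R → relabelRow g (relabelRow h R) ≡ relabelRow (λ c v → g c (h c v)) R
    row g h []      = refl
    row g h (x ∷ R) = cong (g 0 (h 0 x) ∷_) (row (g ∘ suc) (h ∘ suc) R)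
    tableau : ∀ (g : ℕ → ℕ → B → C) (h : ℕ → ℕ → A → B) T →
              relabelTableau g (relabelTableau h T) ≡ relabelTableau (λ r c v → g r c (h r c v)) T
    tableau g h []      = refl
    tableau g h (R ∷ T) = cong₂ _∷_ (row (g 0) (h 0) R) (tableau (g ∘ suc) (h ∘ suc) T)

module _ {A : Set} where

  relabel-id : ∀ {k} (𝒯 : Vec (List (List A)) k) → relabel (λ _ v → v) 𝒯 ≡ 𝒯
  relabel-id []      = refl
  relabel-id (T ∷ 𝒯) = cong₂ _∷_ (tableau T) (relabel-id 𝒯)
    where
    row : ∀ R → relabelRow (λ _ v → v) R ≡ R
    row []      = refl
    row (x ∷ R) = cong (x ∷_) (row R)
    tableau : ∀ T → relabelTableau (λ _ _ v → v) T ≡ T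
    tableau []      = refl
    tableau (R ∷ T) = cong₂ _∷_ (row R) (tableau T)

module _ {A B : Set} where

  mapEntries-relabel : ∀ {k} (f : A → B) (𝒯 : Vec _ k) → mapEntries f 𝒯 ≡ relabel (λ _ → f) 𝒯
  mapEntries-relabel f []      = refl
  mapEntries-relabel f (T ∷ 𝒯) = cong₂ _∷_ (tableau T) (mapEntries-relabel f 𝒯)
    where
    row : ∀ R → map f R ≡ relabelRow (λ _ → f) R
    row []      = refl
    row (x ∷ R) = cong (f x ∷_) (row R)
    tableau : ∀ T → map (map f) T ≡ relabelTableau (λ _ _ → f) T
    tableau []      = refl
    tableau (R ∷ T) = cong₂ _∷_ (row R) (tableau T)

  flatten-mapEntries : ∀ {k} (f : A → B) (𝒯 : Vec _ k) → flatten (mapEntries f 𝒯) ≡ map f (flatten 𝒯)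
  flatten-mapEntries f []      = refl
  flatten-mapEntries f (T ∷ 𝒯) = begin
    concat (map (map f) T) ++ flatten (mapEntries f 𝒯) ≡⟨ cong₂ _++_ (List.concat-map T) (flatten-mapEntries f 𝒯) ⟩
    map f (concat T) ++ map f (flatten 𝒯)              ≡⟨ List.map-++ f (concat T) (flatten 𝒯) ⟨
    map f (concat T ++ flatten 𝒯)                      ∎
    where open ≡-Reasoning

cells : ∀ {A : Set} {k} → Vec (List (List A)) k → List (Cell × A)
cells = flatten ∘ relabel _,_

module _ {A : Set} {k} {𝒯 : Vec (List (List A)) k} where

  ∈cells⁺ : ∀ {x v} → 𝒯 [ x ]= v → (x , v) ∈ cells 𝒯
  ∈cells⁺ = []=⇒∈flatten ∘ relabel-[]=⁺

  ∈cells⁻ : ∀ {x v} → (x , v) ∈ cells 𝒯 → 𝒯 [ x ]= v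
  ∈cells⁻ xv∈ with ∈relabel⁻ {𝒯 = 𝒯} xv∈
  ... | _ , _ , p , refl = p

module _ {A : Set} {k} (𝒯 : Vec (List (List A)) k) where

  cells-unique : Unique (cells 𝒯)
  cells-unique = relabel-unique {𝒯 = 𝒯} ,-injectiveˡ

  flatten-relabel : ∀ {B : Set} (h : Cell → A → B) → flatten (relabel h 𝒯) ≡ map (uncurry h) (cells 𝒯)
  flatten-relabel h = begin
    flatten (relabel h 𝒯)                           ≡⟨ cong flatten (relabel-relabel (λ _ → uncurry h) _,_ 𝒯) ⟨
    flatten (relabel (λ _ → uncurry h) (relabel _,_ 𝒯)) ≡⟨ cong flatten (mapEntries-relabel (uncurry h) (relabel _,_ 𝒯)) ⟨
    flatten (mapEntries (uncurry h) (relabel _,_ 𝒯)) ≡⟨ flatten-mapEntries (uncurry h) (relabel _,_ 𝒯) ⟩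
    map (uncurry h) (cells 𝒯)                        ∎
    where open ≡-Reasoning

  cells-relabel : ∀ {B : Set} (h : Cell → A → B) → cells (relabel h 𝒯) ≡ map (λ (x , v) → x , h x v) (cells 𝒯)
  cells-relabel h = trans (cong flatten (relabel-relabel _,_ h 𝒯)) (flatten-relabel (λ x v → x , h x v))

  entries-cells : map proj₂ (cells 𝒯) ≡ flatten 𝒯
  entries-cells = trans (sym (flatten-relabel (λ _ v → v))) (cong flatten (relabel-id 𝒯))

  ∈flatten⇒[]= : ∀ {v} → v ∈ flatten 𝒯 → ∃[ x ] 𝒯 [ x ]= v
  ∈flatten⇒[]= v∈
    with x , _ , p , refl ← ∈relabel⁻ {h = λ _ v → v} {𝒯 = 𝒯} (subst (_ ∈_) (cong flatten (sym (relabel-id 𝒯))) v∈)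
    = x , p

shape-relabel : ∀ {k} (h : Cell → ℕ → ℕ) (𝒯 : Vec Tableau k) → Vec.map shape (relabel h 𝒯) ≡ Vec.map shape 𝒯
shape-relabel h []      = refl
shape-relabel h (T ∷ 𝒯) = cong₂ _∷_ (tableau (λ r c → h (0 , r , c)) T) (shape-relabel (h ∘ nextComponent) 𝒯)
  where
  row : ∀ (h : ℕ → ℕ → ℕ) R → length (relabelRow h R) ≡ length R
  row h []      = refl
  row h (x ∷ R) = cong suc (row (h ∘ suc) R)
  tableau : ∀ (h : ℕ → ℕ → ℕ → ℕ) T → shape (relabelTableau h T) ≡ shape T
  tableau h []      = refl
  tableau h (R ∷ T) = cong₂ _∷_ (row (h 0) R) (tableau (h ∘ suc) T)

≡ᵇ⇒≡ : ∀ {m n} → (m ≡ᵇ n) ≡ true → m ≡ n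
≡ᵇ⇒≡ {m} {n} eq = ℕ.≡ᵇ⇒≡ m n (subst T (sym eq) tt)

≢ᵇ⇒≢ : ∀ {m n} → (m ≡ᵇ n) ≡ false → m ≢ n
≢ᵇ⇒≢ {m} {n} eq m≡n = subst T eq (ℕ.≡⇒≡ᵇ m n m≡n)

findRow-sound : ∀ v c₀ R {c′} → findRow v c₀ R ≡ just c′ → ∃[ c ] c′ ≡ c₀ + c × AtRow R c v
findRow-sound v c₀ (x ∷ R) eq with x ≡ᵇ v in x≡ᵇv
findRow-sound v c₀ (x ∷ R) refl | true  = 0 , sym (ℕ.+-identityʳ c₀) , subst (AtRow (x ∷ R) 0) (≡ᵇ⇒≡ x≡ᵇv) here
findRow-sound v c₀ (x ∷ R) eq   | false with c , refl , p ← findRow-sound v (suc c₀) R eq =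
  suc c , sym (ℕ.+-suc c₀ c) , there p

findRow-complete : ∀ v c₀ R {c} → AtRow R c v → ∃[ c′ ] findRow v c₀ R ≡ just c′
findRow-complete v c₀ (x ∷ R) p with x ≡ᵇ v in x≡ᵇv
findRow-complete v c₀ (x ∷ R) p         | true  = c₀ , refl
findRow-complete v c₀ (x ∷ R) here      | false = contradiction refl (≢ᵇ⇒≢ {v} x≡ᵇv)
findRow-complete v c₀ (x ∷ R) (there p) | false = findRow-complete v (suc c₀) R p

findTab-sound : ∀ v r₀ T {z} → findTab v r₀ T ≡ just z →
                ∃[ r ] ∃[ c ] z ≡ + c ℤ.- + (r₀ + r) × AtTableau T r c v
findTab-sound v r₀ (R ∷ T) eq with findRow v 0 R in found
findTab-sound v r₀ (R ∷ T) refl | just _ with c , refl , p ← findRow-sound v 0 R found =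
  0 , c , cong (λ r → + c ℤ.- + r) (sym (ℕ.+-identityʳ r₀)) , here p
findTab-sound v r₀ (R ∷ T) eq | nothing with r , c , refl , p ← findTab-sound v (suc r₀) T eq =
  suc r , c , cong (λ r → + c ℤ.- + r) (sym (ℕ.+-suc r₀ r)) , there p

findTab-complete : ∀ v r₀ T {r c} → AtTableau T r c v → ∃[ z ] findTab v r₀ T ≡ just z
findTab-complete v r₀ (R ∷ T) p with findRow v 0 R in found
findTab-complete v r₀ (R ∷ T) p         | just _  = _ , refl
findTab-complete v r₀ (R ∷ T) (here p)  | nothing with _ , found′ ← findRow-complete v 0 R p =
  contradiction (trans (sym found) found′) λ ()
findTab-complete v r₀ (R ∷ T) (there p) | nothing = findTab-complete v (suc r₀) T p

findTup-sound : ∀ {k} v j₀ (𝒯 : Vec Tableau k) {j′ z} → findTup v j₀ (Vec.toList 𝒯) ≡ just (j′ , z) →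
                ∃[ j ] ∃[ r ] ∃[ c ] j′ ≡ j₀ + j × z ≡ content (j , r , c) × 𝒯 [ j , r , c ]= v
findTup-sound v j₀ (T ∷ 𝒯) eq with findTab v 0 T in found
findTup-sound v j₀ (T ∷ 𝒯) refl | just _ with r , c , refl , p ← findTab-sound v 0 T found =
  0 , r , c , sym (ℕ.+-identityʳ j₀) , refl , here p
findTup-sound v j₀ (T ∷ 𝒯) eq | nothing with j , r , c , refl , refl , p ← findTup-sound v (suc j₀) 𝒯 eq =
  suc j , r , c , sym (ℕ.+-suc j₀ j) , refl , there p

findTup-complete : ∀ {k} v j₀ (𝒯 : Vec Tableau k) {j r c} → 𝒯 [ j , r , c ]= v →
                   ∃[ j′ ] ∃[ z ] findTup v j₀ (Vec.toList 𝒯) ≡ just (j′ , z) × j′ ≤ j₀ + j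
findTup-complete v j₀ (T ∷ 𝒯) {j} p with findTab v 0 T in found
findTup-complete v j₀ (T ∷ 𝒯) {j} p | just z = j₀ , z , refl , ℕ.m≤m+n j₀ j
findTup-complete v j₀ (T ∷ 𝒯) (here p) | nothing with _ , found′ ← findTab-complete v 0 T p =
  contradiction (trans (sym found) found′) λ ()
findTup-complete v j₀ (T ∷ 𝒯) (there {j = j} p) | nothing
  with j′ , z , found′ , j′≤ ← findTup-complete v (suc j₀) 𝒯 p =
  j′ , z , found′ , subst (j′ ≤_) (sym (ℕ.+-suc j₀ j)) j′≤

module _ {k} {𝒯 : Vec Tableau k} where

  locate-sound : ∀ {v j z} → locate 𝒯 v ≡ just (j , z) → ∃[ r ] ∃[ c ] z ≡ content (j , r , c) × 𝒯 [ j , r , c ]= v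
  locate-sound {v} eq with _ , r , c , refl , z≡ , p ← findTup-sound v 0 𝒯 eq = r , c , z≡ , p

  locate-complete : ∀ {v j r c} → 𝒯 [ j , r , c ]= v → ∃[ j′ ] ∃[ z ] locate 𝒯 v ≡ just (j′ , z) × j′ ≤ j
  locate-complete {v} = findTup-complete v 0 𝒯

  locate-unique : ∀ {v x} → 𝒯 [ x ]= v → (∀ {y} → 𝒯 [ y ]= v → y ≡ x) → locate 𝒯 v ≡ just (proj₁ x , content x)
  locate-unique {v} {j , r , c} p unique with locate-complete p
  ... | _ , _ , found , _ with r′ , c′ , refl , q ← locate-sound found with refl ← unique q = found

entry : Cell → ℕ → ℕ
entry _ v = v

Increases : ∀ {k} → (ℕ → ℕ → Set) → (Cell → Cell) → (Cell → ℕ → ℕ) → Vec Tableau k → Set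
Increases _∼_ step h 𝒯 = ∀ {x v w} → 𝒯 [ x ]= v → 𝒯 [ step x ]= w → h x v ∼ h (step x) w

record RowPredicate (_∼_ : ℕ → ℕ → Set) (Row : List ℕ → Set) : Set where
  field
    nil  : Row []
    one  : ∀ {x} → Row (x ∷ [])
    cons : ∀ {x y xs} → x ∼ y → Row (y ∷ xs) → Row (x ∷ y ∷ xs)
    head : ∀ {x y xs} → Row (x ∷ y ∷ xs) → x ∼ y
    tail : ∀ {x y xs} → Row (x ∷ y ∷ xs) → Row (y ∷ xs)

rowStrict : RowPredicate _<_ RowStrict
rowStrict = record { nil = tt ; one = tt ; cons = _,_ ; head = proj₁ ; tail = proj₂ }

rowWeak : RowPredicate _≤_ RowWeak
rowWeak = record { nil = tt ; one = tt ; cons = _,_ ; head = proj₁ ; tail = proj₂ }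

module _ {_∼_ : ℕ → ℕ → Set} {Row : List ℕ → Set} (isRow : RowPredicate _∼_ Row) where
  open RowPredicate isRow

  rows-increase : ∀ {k} {𝒯 : Vec Tableau k} → VAll.All (All Row) 𝒯 → Increases _∼_ right entry 𝒯
  rows-increase (rows VAll.∷ _)    (here p)  (here q)  = tableau rows p q
    where
    row : ∀ {R c v w} → Row R → AtRow R c v → AtRow R (suc c) w → v ∼ w
    row {_ ∷ _ ∷ _} R↑ here      (there here) = head R↑
    row {_ ∷ _ ∷ _} R↑ (there p) (there q)    = row (tail R↑) p q
    tableau : ∀ {T r c v w} → All Row T → AtTableau T r c v → AtTableau T r (suc c) w → v ∼ w
    tableau (R↑ ∷ _)  (here p)  (here q)  = row R↑ p q
    tableau (_ ∷ T↑) (there p) (there q) = tableau T↑ p q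
  rows-increase (_ VAll.∷ 𝒯↑) (there p) (there q) = rows-increase 𝒯↑ p q

  relabel-rows : ∀ {k} {h} {𝒯 : Vec Tableau k} → Increases _∼_ right h 𝒯 → VAll.All (All Row) (relabel h 𝒯)
  relabel-rows {𝒯 = []}    h↑ = VAll.[]
  relabel-rows {𝒯 = T ∷ 𝒯} h↑ = tableau T (λ p q → h↑ (here p) (here q)) VAll.∷ relabel-rows (λ p q → h↑ (there p) (there q))
    where
    row : ∀ {h : ℕ → ℕ → ℕ} R → (∀ {c v w} → AtRow R c v → AtRow R (suc c) w → h c v ∼ h (suc c) w) →
          Row (relabelRow h R)
    row []          h↑ = nil
    row (x ∷ [])    h↑ = one
    row (x ∷ y ∷ R) h↑ = cons (h↑ here (there here)) (row (y ∷ R) (λ p q → h↑ (there p) (there q)))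
    tableau : ∀ {h : ℕ → ℕ → ℕ → ℕ} T →
              (∀ {r c v w} → AtTableau T r c v → AtTableau T r (suc c) w → h r c v ∼ h r (suc c) w) →
              All Row (relabelTableau h T)
    tableau []      h↑ = []
    tableau (R ∷ T) h↑ = row R (λ p q → h↑ (here p) (here q)) ∷ tableau T (λ p q → h↑ (there p) (there q))

columns-increase : ∀ {k} {𝒯 : Vec Tableau k} → VAll.All ColStrict 𝒯 → Increases _<_ below entry 𝒯
columns-increase (cols VAll.∷ _)    (here p)  (here q)  = tableau cols p q
  where
  pair : ∀ {R R′ c v w} → ColStrictPair R R′ → AtRow R c v → AtRow R′ c w → v < w
  pair {_ ∷ _} {_ ∷ _} (v<w , _) here      here      = v<w
  pair {_ ∷ _} {_ ∷ _} (_ , R↑) (there p) (there q) = pair R↑ p q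
  tableau : ∀ {T r c v w} → ColStrict T → AtTableau T r c v → AtTableau T (suc r) c w → v < w
  tableau {_ ∷ _ ∷ _} (R↑ , _) (here p)  (there (here q)) = pair R↑ p q
  tableau {_ ∷ _ ∷ _} (_ , T↑) (there p) (there q)        = tableau T↑ p q
columns-increase (_ VAll.∷ 𝒯↑) (there p) (there q) = columns-increase 𝒯↑ p q

relabel-columns : ∀ {k} {h} {𝒯 : Vec Tableau k} → VAll.All ColStrict 𝒯 → Increases _<_ below h 𝒯 →
                  VAll.All ColStrict (relabel h 𝒯)
relabel-columns {𝒯 = []}    VAll.[]            h↑ = VAll.[]
relabel-columns {𝒯 = T ∷ 𝒯} (cols VAll.∷ 𝒯↑) h↑ =
  tableau T cols (λ p q → h↑ (here p) (here q)) VAll.∷ relabel-columns 𝒯↑ (λ p q → h↑ (there p) (there q))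
  where
  pair : ∀ {h h′ : ℕ → ℕ → ℕ} R R′ → ColStrictPair R R′ →
         (∀ {c v w} → AtRow R c v → AtRow R′ c w → h c v < h′ c w) →
         ColStrictPair (relabelRow h R) (relabelRow h′ R′)
  pair R       []       _        h↑ = tt
  pair (x ∷ R) (y ∷ R′) (_ , R↑) h↑ = h↑ here here , pair R R′ R↑ (λ p q → h↑ (there p) (there q))
  tableau : ∀ {h : ℕ → ℕ → ℕ → ℕ} T → ColStrict T →
            (∀ {r c v w} → AtTableau T r c v → AtTableau T (suc r) c w → h r c v < h (suc r) c w) →
            ColStrict (relabelTableau h T)
  tableau []           _          h↑ = tt
  tableau (R ∷ [])     _          h↑ = tt
  tableau (R ∷ R′ ∷ T) (R↑ , T↑) h↑ =
    pair R R′ R↑ (λ p q → h↑ (here p) (there (here q))) , tableau (R′ ∷ T) T↑ (λ p q → h↑ (there p) (there q))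

left-neighbour : ∀ {A : Set} {k} {𝒯 : Vec (List (List A)) k} {j r c w} → 𝒯 [ j , r , suc c ]= w → ∃[ v ] 𝒯 [ j , r , c ]= v
left-neighbour (here p)  = let v , q = tableau p in v , here q
  where
  row : ∀ {R c w} → AtRow R (suc c) w → ∃[ v ] AtRow R c v
  row (there here)      = _ , here
  row (there (there p)) = let v , q = row (there p) in v , there q
  tableau : ∀ {T r c w} → AtTableau T r (suc c) w → ∃[ v ] AtTableau T r c v
  tableau (here p)  = let v , q = row p in v , here q
  tableau (there p) = let v , q = tableau p in v , there q
left-neighbour (there p) = let v , q = left-neighbour p in v , there q

upper-neighbour : ∀ {k} {𝒯 : Vec Tableau k} {j r c w} → VAll.All ColStrict 𝒯 →
                  𝒯 [ j , suc r , c ]= w → ∃[ v ] 𝒯 [ j , r , c ]= v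
upper-neighbour (cols VAll.∷ _) (here p)  = let v , q = tableau cols p in v , here q
  where
  pair : ∀ {R R′ c w} → ColStrictPair R R′ → AtRow R′ c w → ∃[ v ] AtRow R c v
  pair {_ ∷ _} {_ ∷ _} _        here      = _ , here
  pair {_ ∷ _} {_ ∷ _} (_ , R↑) (there p) = let v , q = pair R↑ p in v , there q
  tableau : ∀ {T r c w} → ColStrict T → AtTableau T (suc r) c w → ∃[ v ] AtTableau T r c v
  tableau {_ ∷ _ ∷ _} (R↑ , _) (there (here p))  = let v , q = pair R↑ p in v , here q
  tableau {_ ∷ _ ∷ _} (_ , T↑) (there (there p)) = let v , q = tableau T↑ (there p) in v , there q
upper-neighbour (_ VAll.∷ 𝒯↑) (there p) = let v , q = upper-neighbour 𝒯↑ p in v , there q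

module _ {k} {𝒯 : Vec Tableau k} where

  left-≤ : Increases _≤_ right entry 𝒯 → ∀ {j r c c′ w} → c ≤′ c′ → 𝒯 [ j , r , c′ ]= w →
           ∃[ v ] 𝒯 [ j , r , c ]= v × v ≤ w
  left-≤ rows ≤′-refl       p = _ , p , ℕ.≤-refl
  left-≤ rows (≤′-step c≤c′) p with u , q ← left-neighbour p with v , s , v≤u ← left-≤ rows c≤c′ q =
    v , s , ℕ.≤-trans v≤u (rows q p)

  above-≤ : VAll.All ColStrict 𝒯 → ∀ {j r r′ c w} → r ≤′ r′ → 𝒯 [ j , r′ , c ]= w →
            ∃[ v ] 𝒯 [ j , r , c ]= v × v ≤ w
  above-≤ cols ≤′-refl        p = _ , p , ℕ.≤-refl
  above-≤ cols (≤′-step r≤r′) p with u , q ← upper-neighbour cols p with v , s , v≤u ← above-≤ cols r≤r′ q =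
    v , s , ℕ.≤-trans v≤u (ℕ.<⇒≤ (columns-increase cols q p))

  above-< : VAll.All ColStrict 𝒯 → ∀ {j r r′ c w} → r < r′ → 𝒯 [ j , r′ , c ]= w → ∃[ v ] 𝒯 [ j , r , c ]= v × v < w
  above-< cols {r′ = suc r′} (s≤s r≤r′) p
    with u , q ← upper-neighbour cols p with v , s , v≤u ← above-≤ cols (ℕ.≤⇒≤′ r≤r′) q =
    v , s , ℕ.≤-<-trans v≤u (columns-increase cols q p)

  corner-≤ : Increases _≤_ right entry 𝒯 → VAll.All ColStrict 𝒯 → ∀ {j r c w} → 𝒯 [ j , r , c ]= w →
             ∃[ v ] 𝒯 [ j , 0 , 0 ]= v × v ≤ w
  corner-≤ rows cols p
    with u , q , u≤w ← left-≤ rows (ℕ.≤⇒≤′ z≤n) p with v , s , v≤u ← above-≤ cols (ℕ.≤⇒≤′ z≤n) q =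
    v , s , ℕ.≤-trans v≤u u≤w

++-split : ∀ {A : Set} {xs ys zs ws : List A} → length xs ≡ length ys → xs ++ zs ≡ ys ++ ws → xs ≡ ys × zs ≡ ws
++-split {xs = []}     {[]}     _   eq = refl , eq
++-split {xs = x ∷ xs} {y ∷ ys} len eq with refl , eq′ ← List.∷-injective eq
  with refl , zs≡ ← ++-split {xs = xs} {ys} (ℕ.suc-injective len) eq′ = refl , zs≡

length-concat : ∀ (T : Tableau) → length (concat T) ≡ size (shape T)
length-concat []      = refl
length-concat (R ∷ T) = trans (List.length-++ R) (cong (λ n → length R + n) (length-concat T))

length-flatten : ∀ {k} (𝒯 : Vec Tableau k) → length (flatten 𝒯) ≡ totalSize (Vec.map shape 𝒯)
length-flatten []      = refl
length-flatten (T ∷ 𝒯) = trans (List.length-++ (concat T)) (cong₂ _+_ (length-concat T) (length-flatten 𝒯))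

tuple-≡ : ∀ {k} {𝒯 𝒯′ : Vec Tableau k} →
          Vec.map shape 𝒯 ≡ Vec.map shape 𝒯′ → flatten 𝒯 ≡ flatten 𝒯′ → 𝒯 ≡ 𝒯′
tuple-≡ {𝒯 = []}    {[]}      _   _  = refl
tuple-≡ {𝒯 = T ∷ 𝒯} {T′ ∷ 𝒯′} shp eq
  with shpT , shp𝒯 ← Vec.∷-injective shp
  with T≡ , 𝒯≡ ← ++-split (trans (length-concat T) (trans (cong size shpT) (sym (length-concat T′)))) eq =
  cong₂ _∷_ (tableau T T′ shpT T≡) (tuple-≡ shp𝒯 𝒯≡)
  where
  tableau : ∀ T T′ → shape T ≡ shape T′ → concat T ≡ concat T′ → T ≡ T′
  tableau []      []        _   _  = refl
  tableau (R ∷ T) (R′ ∷ T′) shp eq with lenR , shpT ← List.∷-injective shp with refl , T≡ ← ++-split {xs = R} {R′} lenR eq =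
    cong (R ∷_) (tableau T T′ shpT T≡)

-- Contents and descents

content-below : ∀ {x} → content (below x) ℤ.< content x
content-below {_ , r , c} = ℤ.+-monoʳ-< (+ c) (ℤ.neg-mono-< (+<+ (ℕ.n<1+n r)))

content-right : ∀ {x} → content x ℤ.< content (right x)
content-right {_ , r , c} = ℤ.+-monoˡ-< (ℤ.- + r) (+<+ (ℕ.n<1+n c))

content-≡⇒ : ∀ {j r c j′ r′ c′} → content (j , r , c) ≡ content (j′ , r′ , c′) → c + r′ ≡ c′ + r
content-≡⇒ {r = r} {c} {r′ = r′} {c′} eq = ℤ.+-injective (begin
  + (c + r′)                         ≡⟨ ℤ.pos-+ c r′ ⟩
  + c ℤ.+ + r′                       ≡⟨ shift (+ c) (+ r) (+ r′) ⟩
  (+ c ℤ.- + r) ℤ.+ (+ r ℤ.+ + r′)   ≡⟨ cong (ℤ._+ (+ r ℤ.+ + r′)) eq ⟩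
  (+ c′ ℤ.- + r′) ℤ.+ (+ r ℤ.+ + r′) ≡⟨ shift′ (+ c′) (+ r) (+ r′) ⟩
  + c′ ℤ.+ + r                       ≡⟨ ℤ.pos-+ c′ r ⟨
  + (c′ + r)                         ∎)
  where
  open ≡-Reasoning
  shift : ∀ a b d → a ℤ.+ d ≡ (a ℤ.- b) ℤ.+ (b ℤ.+ d)
  shift = solve-∀
  shift′ : ∀ a b d → (a ℤ.- d) ℤ.+ (b ℤ.+ d) ≡ a ℤ.+ b
  shift′ = solve-∀

locus : Cell → ℤ × ℕ
locus x = content x , proj₁ x

_⊑_ _⊏_ : Rel (ℤ × ℕ) 0ℓ
_⊑_ = ×-Lex _≡_ ℤ._<_ _≤_
_⊏_ = ×-Lex _≡_ ℤ._<_ _<_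

⊑-refl : ∀ {p} → p ⊑ p
⊑-refl = inj₂ (refl , ℕ.≤-refl)

⊑-trans : Transitive _⊑_
⊑-trans = ×-transitive {_<₂_ = _≤_} isEquivalence (resp₂ ℤ._<_) ℤ.<-trans ℕ.≤-trans

⊏-isStrictTotalOrder : IsStrictTotalOrder _≡_ _⊏_
⊏-isStrictTotalOrder = ×-Lex-isStrictTotalOrder ℤ.<-isStrictTotalOrder ℕ.<-isStrictTotalOrder

⊑∧≢⇒⊏ : ∀ {p q} → p ⊑ q → p ≢ q → p ⊏ q
⊑∧≢⇒⊏ (inj₁ a<b)           _   = inj₁ a<b
⊑∧≢⇒⊏ (inj₂ (refl , s≤t)) p≢q with ℕ.m≤n⇒m<n∨m≡n s≤t
... | inj₁ s<t  = inj₂ (refl , s<t)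
... | inj₂ refl = contradiction refl p≢q

⊏⇒⋢ : ∀ {p q} → p ⊏ q → ¬ q ⊑ p
⊏⇒⋢ (inj₁ a<b)          (inj₁ b<a)          = ℤ.<-asym a<b b<a
⊏⇒⋢ (inj₁ a<b)          (inj₂ (refl , _))   = ℤ.<-irrefl refl a<b
⊏⇒⋢ (inj₂ (refl , _))   (inj₁ b<a)          = ℤ.<-irrefl refl b<a
⊏⇒⋢ (inj₂ (refl , s<t)) (inj₂ (_ , t≤s))    = ℕ.<⇒≱ s<t t≤s

module _ {k} (𝒯 : Vec Tableau k) {i s t a b} (at-i : locate 𝒯 i ≡ just (s , a)) (at-i+1 : locate 𝒯 (suc i) ≡ just (t , b)) where

  private
    isDescent-located : isDescent 𝒯 i ≡ (if s ≤ᵇ t then does (b ℤ.<? a) else does (b ℤ.≤? a))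
    isDescent-located rewrite at-i | at-i+1 = refl

  nonDescent⇒⊑ : isDescent 𝒯 i ≡ false → (a , s) ⊑ (b , t)
  -- the clauses where the if-expression in eq evaluates to true are absurd and omitted
  nonDescent⇒⊑ nd with trans (sym isDescent-located) nd
  ... | eq with s ≤ᵇ t in s≤ᵇt | b ℤ.<? a | b ℤ.≤? a
  ...   | true  | no b≮a | _      = case (a ℤ.≟ b)
    where
    case : Dec (a ≡ b) → (a , s) ⊑ (b , t)
    case (yes a≡b) = inj₂ (a≡b , ℕ.≤ᵇ⇒≤ s t (subst T (sym s≤ᵇt) _))
    case (no a≢b)  = inj₁ (ℤ.≤∧≢⇒< (ℤ.≮⇒≥ b≮a) a≢b)
  ...   | false | _      | no b≰a = inj₁ (ℤ.≰⇒> b≰a)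

  ⊏⇒nonDescent : (a , s) ⊏ (b , t) → isDescent 𝒯 i ≡ false
  ⊏⇒nonDescent a,s⊏b,t rewrite isDescent-located with s ≤ᵇ t in s≤ᵇt | b ℤ.<? a | b ℤ.≤? a
  ... | true  | no _    | _     = refl
  ... | true  | yes b<a | _     = contradiction (inj₁ b<a) (⊏⇒⋢ a,s⊏b,t)
  ... | false | _       | no _  = refl
  ... | false | _       | yes b≤a with a,s⊏b,t
  ...   | inj₁ a<b          = contradiction (ℤ.<-≤-trans a<b b≤a) (ℤ.<-irrefl refl)
  ...   | inj₂ (refl , s<t) = contradiction (ℕ.≤⇒≤ᵇ (ℕ.<⇒≤ s<t)) (subst T s≤ᵇt)

-- The entries of φ(α, 𝒯)

descent? : ∀ {k} (𝒯 : Vec Tableau k) → Decidable (T ∘ isDescent 𝒯)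
descent? 𝒯 = T? ∘ isDescent 𝒯

descentAt : ∀ {k} → Vec Tableau k → ℕ → ℕ
descentAt 𝒯 i = count (descent? 𝒯) [ i ]

module _ {k} (𝒯 : Vec Tableau k) where

  descentAt-≤1 : ∀ i → descentAt 𝒯 i ≤ 1
  descentAt-≤1 i = List.length-filter (descent? 𝒯) [ i ]

  descentAt-true : ∀ {i} → isDescent 𝒯 i ≡ true → descentAt 𝒯 i ≡ 1
  descentAt-true d = cong length (List.filter-accept (descent? 𝒯) (subst T (sym d) _))

  descentAt-false : ∀ {i} → isDescent 𝒯 i ≡ false → descentAt 𝒯 i ≡ 0
  descentAt-false nd = cong length (List.filter-reject (descent? 𝒯) (subst T nd))

  dBelow-suc : ∀ s → dBelow 𝒯 (suc (suc s)) ≡ dBelow 𝒯 (suc s) + descentAt 𝒯 (suc s)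
  dBelow-suc s = trans (cong (count (descent? 𝒯)) (oneTo-∷ʳ s)) (count-++ (descent? 𝒯) (oneTo s) [ suc s ])

  dBelow-mono : ∀ {s s′} → s ≤′ s′ → dBelow 𝒯 s ≤ dBelow 𝒯 s′
  dBelow-mono ≤′-refl           = ℕ.≤-refl
  dBelow-mono (≤′-step {zero} s≤s′)  = dBelow-mono s≤s′
  dBelow-mono (≤′-step {suc s′} s≤s′) =
    ℕ.≤-trans (dBelow-mono s≤s′) (subst (dBelow 𝒯 (suc s′) ≤_) (sym (dBelow-suc s′)) (ℕ.m≤m+n _ _))

sum-take-mono : ∀ (xs : List ℕ) {m n} → m ≤ n → sum (take m xs) ≤ sum (take n xs)
sum-take-mono []       {zero}  _         = z≤n
sum-take-mono []       {suc m} _         = z≤n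
sum-take-mono (x ∷ xs) {zero}  _         = z≤n
sum-take-mono (x ∷ xs) {suc m} (s≤s m≤n) = ℕ.+-monoʳ-≤ x (sum-take-mono xs m≤n)

fill : ∀ {k n} → Vec ℕ n → Vec Tableau k → ℕ → ℕ
fill α 𝒯 s = 1 + dBelow 𝒯 s + sum (take (s ∸ 1) (Vec.toList α))

module _ {k n} (α : Vec ℕ n) (𝒯 : Vec Tableau k) where

  fill-mono : ∀ {s s′} → s ≤ s′ → fill α 𝒯 s ≤ fill α 𝒯 s′
  fill-mono s≤s′ =
    s≤s (ℕ.+-mono-≤ (dBelow-mono 𝒯 (ℕ.≤⇒≤′ s≤s′)) (sum-take-mono (Vec.toList α) (ℕ.∸-monoˡ-≤ 1 s≤s′)))

  fill-descent : ∀ {i} → 1 ≤ i → isDescent 𝒯 i ≡ true → fill α 𝒯 i < fill α 𝒯 (suc i)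
  fill-descent {suc i} _ d = s≤s (ℕ.+-mono-<-≤ dBelow< (sum-take-mono (Vec.toList α) (ℕ.n≤1+n i)))
    where
    dBelow< : dBelow 𝒯 (suc i) < dBelow 𝒯 (suc (suc i))
    dBelow< = ℕ.≤-reflexive (sym (begin
      dBelow 𝒯 (suc (suc i))            ≡⟨ dBelow-suc 𝒯 i ⟩
      dBelow 𝒯 (suc i) + descentAt 𝒯 (suc i) ≡⟨ cong (λ t → dBelow 𝒯 (suc i) + t) (descentAt-true 𝒯 d) ⟩
      dBelow 𝒯 (suc i) + 1              ≡⟨ ℕ.+-comm _ 1 ⟩
      suc (dBelow 𝒯 (suc i))            ∎))
      where open ≡-Reasoning

  fill-flat⇒nonDescent : ∀ {a b} m → 1 ≤ a → a ≤ m → m < b → fill α 𝒯 b ≤ fill α 𝒯 a → isDescent 𝒯 m ≡ false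
  fill-flat⇒nonDescent {a} {b} m 1≤a a≤m m<b fb≤fa with isDescent 𝒯 m in d
  ... | false = refl
  ... | true  = contradiction fb≤fa (ℕ.<⇒≱ (begin-strict
    fill α 𝒯 a       ≤⟨ fill-mono a≤m ⟩
    fill α 𝒯 m       <⟨ fill-descent (ℕ.≤-trans 1≤a a≤m) d ⟩
    fill α 𝒯 (suc m) ≤⟨ fill-mono m<b ⟩
    fill α 𝒯 b       ∎))
    where open ℕ.≤-Reasoning

  fill-last : fill α 𝒯 (suc n) ≡ suc (dBelow 𝒯 (suc n) + ∣ α ∣)
  fill-last = cong (λ t → suc (dBelow 𝒯 (suc n) + t)) (sum-take-all α)
    where
    sum-take-all : ∀ {m} (β : Vec ℕ m) → sum (take m (Vec.toList β)) ≡ ∣ β ∣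
    sum-take-all []      = refl
    sum-take-all (b ∷ β) = cong (λ t → b + t) (sum-take-all β)

tabulateFrom : (ℕ → ℕ) → ℕ → (n : ℕ) → Vec ℕ n
tabulateFrom A o zero    = []
tabulateFrom A o (suc n) = A o ∷ tabulateFrom A (suc o) n

sum-take-tabulateFrom : ∀ A o {m n} → suc m ≤ n →
  sum (take (suc m) (Vec.toList (tabulateFrom A o n))) ≡ sum (take m (Vec.toList (tabulateFrom A o n))) + A (o + m)
sum-take-tabulateFrom A o {zero}  {suc n} _ = trans (ℕ.+-identityʳ (A o)) (cong A (sym (ℕ.+-identityʳ o)))
sum-take-tabulateFrom A o {suc m} {suc n} (s≤s m<n) = begin
  A o + sum (take (suc m) xs)          ≡⟨ cong (λ t → A o + t) (sum-take-tabulateFrom A (suc o) m<n) ⟩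
  A o + (sum (take m xs) + A (suc o + m)) ≡⟨ ℕ.+-assoc (A o) _ _ ⟨
  A o + sum (take m xs) + A (suc o + m)   ≡⟨ cong (λ t → A o + sum (take m xs) + A t) (ℕ.+-suc o m) ⟨
  A o + sum (take m xs) + A (o + suc m)   ∎
  where
  open ≡-Reasoning
  xs : List ℕ
  xs = Vec.toList (tabulateFrom A (suc o) n)

-- α is read off from the increments of G that are not already accounted for by descents
module Interpolation {k} (𝒯 : Vec Tableau k) (G : ℕ → ℕ) (ℓ : ℕ) (G-one : G 1 ≡ 1)
  (G-step : ∀ {s} → 1 ≤ s → suc s ≤ ℓ → G s + descentAt 𝒯 s ≤ G (suc s)) where

  increment : ℕ → ℕ
  increment i = G (suc i) ∸ G i ∸ descentAt 𝒯 i

  interpolant : Vec ℕ (ℓ ∸ 1)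
  interpolant = tabulateFrom increment 1 (ℓ ∸ 1)

  private
    f δ : ℕ → ℕ
    f = fill interpolant 𝒯
    δ = descentAt 𝒯

  fill-step : ∀ {s} → suc (suc s) ≤ ℓ → f (suc (suc s)) ≡ f (suc s) + δ (suc s) + increment (suc s)
  fill-step {s} ss≤ℓ = begin
    suc (dBelow 𝒯 (suc (suc s)) + sum (take (suc s) (Vec.toList interpolant)))
      ≡⟨ cong₂ (λ d p → suc (d + p)) (dBelow-suc 𝒯 s) (sum-take-tabulateFrom increment 1 (ℕ.∸-monoˡ-≤ 1 ss≤ℓ)) ⟩
    suc (dBelow 𝒯 (suc s) + δ (suc s) + (sum (take s (Vec.toList interpolant)) + increment (suc s)))
      ≡⟨ regroup (dBelow 𝒯 (suc s)) (δ (suc s)) (sum (take s (Vec.toList interpolant))) (increment (suc s)) ⟩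
    f (suc s) + δ (suc s) + increment (suc s) ∎
    where
    open ≡-Reasoning
    regroup : ∀ d e p a → suc (d + e + (p + a)) ≡ suc (d + p) + e + a
    regroup = ℕ-Solver.solve-∀

  fill-interpolant : ∀ {s} → 1 ≤ s → s ≤ ℓ → f s ≡ G s
  fill-interpolant {suc zero}     _ _     = sym G-one
  fill-interpolant {suc (suc s)} _ ss≤ℓ = begin
    f (suc (suc s))
      ≡⟨ fill-step ss≤ℓ ⟩
    f (suc s) + δ (suc s) + increment (suc s)
      ≡⟨ cong (λ t → t + δ (suc s) + increment (suc s)) (fill-interpolant (s≤s z≤n) (ℕ.<⇒≤ ss≤ℓ)) ⟩
    G (suc s) + δ (suc s) + (G (suc (suc s)) ∸ G (suc s) ∸ δ (suc s))
      ≡⟨ cong (λ t → G (suc s) + δ (suc s) + t) (ℕ.∸-+-assoc (G (suc (suc s))) (G (suc s)) (δ (suc s))) ⟩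
    G (suc s) + δ (suc s) + (G (suc (suc s)) ∸ (G (suc s) + δ (suc s)))
      ≡⟨ ℕ.m+[n∸m]≡n (G-step (s≤s z≤n) ss≤ℓ) ⟩
    G (suc (suc s)) ∎
    where open ≡-Reasoning

prefixSums-injective : ∀ {n} {α α′ : Vec ℕ n} →
  (∀ {m} → m ≤ n → sum (take m (Vec.toList α)) ≡ sum (take m (Vec.toList α′))) → α ≡ α′
prefixSums-injective {α = []}    {[]}      _  = refl
prefixSums-injective {α = a ∷ α} {a′ ∷ α′} eq = cong₂ _∷_ a≡a′ (prefixSums-injective λ {m} m≤n →
  ℕ.+-cancelˡ-≡ a _ _ (trans (eq (s≤s m≤n)) (cong (λ t → t + sum (take m (Vec.toList α′))) (sym a≡a′))))
  where
  a≡a′ : a ≡ a′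
  a≡a′ = trans (sym (ℕ.+-identityʳ a)) (trans (eq (s≤s z≤n)) (ℕ.+-identityʳ a′))

fill-injectiveˡ : ∀ {k n} (𝒯 : Vec Tableau k) {α α′ : Vec ℕ n} →
  (∀ {m} → m ≤ n → fill α 𝒯 (suc m) ≡ fill α′ 𝒯 (suc m)) → α ≡ α′
fill-injectiveˡ 𝒯 eq = prefixSums-injective λ m≤n → ℕ.+-cancelˡ-≡ _ _ _ (ℕ.suc-injective (eq m≤n))

module SYT {k} {Λ : Vec Partition k} {𝒯 : Vec Tableau k} (𝒯-syt : IsSYTTuple Λ 𝒯) where

  ℓ : ℕ
  ℓ = totalSize Λ

  columns : VAll.All ColStrict 𝒯
  columns = VAll.map proj₂ (proj₁ (proj₂ 𝒯-syt))

  rows↑ : Increases _<_ right entry 𝒯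
  rows↑ = rows-increase rowStrict (VAll.map proj₁ (proj₁ (proj₂ 𝒯-syt)))

  columns↑ : Increases _<_ below entry 𝒯
  columns↑ = columns-increase columns

  values-↭ : map proj₂ (cells 𝒯) ↭ oneTo ℓ
  values-↭ = subst (_↭ oneTo ℓ) (sym (entries-cells 𝒯)) (proj₂ (proj₂ 𝒯-syt))

  entry-range : ∀ {x v} → 𝒯 [ x ]= v → 1 ≤ v × v ≤ ℓ
  entry-range p = ∈oneTo⁻ (↭.∈-resp-↭ values-↭ (∈.∈-map⁺ proj₂ (∈cells⁺ p)))

  cell-of : ∀ {s} → 1 ≤ s → s ≤ ℓ → ∃[ x ] 𝒯 [ x ]= s
  cell-of 1≤s s≤ℓ with (x , _) , xs∈ , refl ← ∈.∈-map⁻ proj₂ (↭.∈-resp-↭ (↭-sym values-↭) (∈oneTo⁺ 1≤s s≤ℓ)) =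
    x , ∈cells⁻ xs∈

  cell-unique : ∀ {x y v} → 𝒯 [ x ]= v → 𝒯 [ y ]= v → x ≡ y
  cell-unique p q = cong proj₁ (Unique-map⁻-∈ values-unique (∈cells⁺ p) (∈cells⁺ q) refl)
    where
    values-unique : Unique (map proj₂ (cells 𝒯))
    values-unique = Unique-resp-↭ (↭-sym values-↭) (oneTo-unique ℓ)

  locate-cell : ∀ {x v} → 𝒯 [ x ]= v → locate 𝒯 v ≡ just (proj₁ x , content x)
  locate-cell p = locate-unique p (λ q → cell-unique q p)

  nonDescents⇒⊑ : ∀ {x y a b} → 𝒯 [ x ]= a → 𝒯 [ y ]= b → a ≤′ b →
                  (∀ {m} → a ≤ m → m < b → isDescent 𝒯 m ≡ false) → locus x ⊑ locus y
  nonDescents⇒⊑ p q ≤′-refl          _  with refl ← cell-unique p q = ⊑-refl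
  nonDescents⇒⊑ p q (≤′-step a≤′b′) nd
    with z , r ← cell-of (ℕ.≤-trans (proj₁ (entry-range p)) (ℕ.≤′⇒≤ a≤′b′)) (ℕ.<⇒≤ (proj₂ (entry-range q))) =
    ⊑-trans (nonDescents⇒⊑ p r a≤′b′ (λ a≤m m<b′ → nd a≤m (ℕ.m≤n⇒m≤1+n m<b′)))
            (nonDescent⇒⊑ 𝒯 (locate-cell r) (locate-cell q) (nd (ℕ.≤′⇒≤ a≤′b′) ℕ.≤-refl))

  one-in-corner : ∀ {j r c} → 𝒯 [ j , r , c ]= 1 → (j , r , c) ≡ (j , 0 , 0)
  one-in-corner p with v , q , v≤1 ← corner-≤ (λ p q → ℕ.<⇒≤ (rows↑ p q)) columns p
                  with refl ← ℕ.≤-antisym v≤1 (proj₁ (entry-range q)) = cell-unique p q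

module Phi {k} {Λ : Vec Partition k} {𝒯 : Vec Tableau k} (𝒯-syt : IsSYTTuple Λ 𝒯) {n} (α : Vec ℕ n) where
  open SYT 𝒯-syt

  private
    f : ℕ → ℕ
    f = fill α 𝒯
    𝔗 : Vec Tableau k
    𝔗 = φ α 𝒯

  φ≡relabel : 𝔗 ≡ relabel (λ _ → f) 𝒯
  φ≡relabel = mapEntries-relabel f 𝒯

  φ-[]=⁺ : ∀ {x v} → 𝒯 [ x ]= v → 𝔗 [ x ]= f v
  φ-[]=⁺ {x} {v} p = subst (λ 𝒰 → 𝒰 [ x ]= f v) (sym φ≡relabel) (relabel-[]=⁺ p)

  φ-[]=⁻ : ∀ {x w} → 𝔗 [ x ]= w → ∃[ v ] 𝒯 [ x ]= v × w ≡ f v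
  φ-[]=⁻ {x} {w} p = relabel-[]=⁻ (subst (λ 𝒰 → 𝒰 [ x ]= w) φ≡relabel p)

  fill-flat⇒⊑ : ∀ {x y a b} → 𝒯 [ x ]= a → 𝒯 [ y ]= b → a ≤ b → f b ≤ f a → locus x ⊑ locus y
  fill-flat⇒⊑ p q a≤b fb≤fa = nonDescents⇒⊑ p q (ℕ.≤⇒≤′ a≤b)
    (λ a≤m m<b → fill-flat⇒nonDescent α 𝒯 _ (proj₁ (entry-range p)) a≤m m<b fb≤fa)

  -- equal entries in a column would force the lower cell to be weakly later in ⊑, but its content is smaller
  fill-columns : Increases _<_ below (λ _ → f) 𝒯
  fill-columns {x} {v} {w} p q with f v ℕ.<? f w
  ... | yes fv<fw = fv<fw
  ... | no fv≮fw = contradiction (fill-flat⇒⊑ p q (ℕ.<⇒≤ (columns↑ p q)) (ℕ.≮⇒≥ fv≮fw))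
                                 (⊏⇒⋢ (inj₁ (content-below {x})))

  fill-rows : Increases _≤_ right (λ _ → f) 𝒯
  fill-rows p q = fill-mono α 𝒯 (ℕ.<⇒≤ (rows↑ p q))

  φ-ssyt : 1 ≤ ℓ → IsSSYTTuple Λ 𝔗
  φ-ssyt 1≤ℓ = shape-φ , semistandard , positive , has-one
    where
    shape-φ : HasShape Λ 𝔗
    shape-φ = trans (cong (Vec.map shape) φ≡relabel) (trans (shape-relabel _ 𝒯) (proj₁ 𝒯-syt))
    semistandard : VAll.All SemistandardTableau 𝔗
    semistandard = subst (VAll.All SemistandardTableau) (sym φ≡relabel)
      (VAll.zip (relabel-rows rowWeak fill-rows , relabel-columns columns fill-columns))
    positive : All (1 ≤_) (tupleEntries 𝔗)
    positive = subst (All (1 ≤_)) (sym (flatten-mapEntries f 𝒯)) (All.map⁺ (All.universal (λ _ → s≤s z≤n) _))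
    has-one : 1 ∈ tupleEntries 𝔗
    has-one = let x , p = cell-of ℕ.≤-refl 1≤ℓ in []=⇒∈flatten (φ-[]=⁺ p)

module SSYT {k} {Λ : Vec Partition k} {𝔗 : Vec Tableau k} (𝔗-ssyt : IsSSYTTuple Λ 𝔗) where

  columns : VAll.All ColStrict 𝔗
  columns = VAll.map proj₂ (proj₁ (proj₂ 𝔗-ssyt))

  rows↑ : Increases _≤_ right entry 𝔗
  rows↑ = rows-increase rowWeak (VAll.map proj₁ (proj₁ (proj₂ 𝔗-ssyt)))

  columns↑ : Increases _<_ below entry 𝔗
  columns↑ = columns-increase columns

module Statistics {k} {Λ : Vec Partition k} {𝒯 : Vec Tableau k} (𝒯-syt : IsSYTTuple Λ 𝒯)
  (1≤ℓ : 1 ≤ totalSize Λ) (α : Vec ℕ (totalSize Λ ∸ 1)) where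
  open SYT 𝒯-syt
  open Phi 𝒯-syt α

  private
    f : ℕ → ℕ
    f = fill α 𝒯
    𝔗 : Vec Tableau k
    𝔗 = φ α 𝒯

  maxEntry-φ : maxEntry 𝔗 ≡ f ℓ
  maxEntry-φ with _ , p ← cell-of 1≤ℓ ℕ.≤-refl = foldr-⊔-≡ ([]=⇒∈flatten (φ-[]=⁺ p)) (All.tabulate bounded)
    where
    bounded : ∀ {w} → w ∈ flatten 𝔗 → w ≤ f ℓ
    bounded w∈ with _ , q ← ∈flatten⇒[]= 𝔗 w∈ with _ , r , refl ← φ-[]=⁻ q = fill-mono α 𝒯 (proj₂ (entry-range r))

  max-statistic : ∣ α ∣ + length (DES Λ 𝒯) + 1 ≡ maxEntry 𝔗
  max-statistic = begin
    ∣ α ∣ + length (DES Λ 𝒯) + 1          ≡⟨ trans (ℕ.+-comm _ 1) (cong suc (ℕ.+-comm ∣ α ∣ _)) ⟩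
    suc (length (DES Λ 𝒯) + ∣ α ∣)        ≡⟨ fill-last α 𝒯 ⟨
    fill α 𝒯 (suc (ℓ ∸ 1))               ≡⟨ cong f (ℕ.suc-pred ℓ {{>-nonZero 1≤ℓ}}) ⟩
    f ℓ                                   ≡⟨ maxEntry-φ ⟨
    maxEntry 𝔗                            ∎
    where open ≡-Reasoning

  private module Image = SSYT (φ-ssyt 1≤ℓ)

  -- the corner of any component of φ(α, 𝒯) containing 1 holds 1 as well
  component-of-one : ∀ {j₁ j₀ r c} → 𝒯 [ j₁ , 0 , 0 ]= 1 → 𝔗 [ j₀ , r , c ]= 1 → j₁ ≤ j₀
  component-of-one p q
    with _ , s , u≤1 ← corner-≤ Image.rows↑ Image.columns q
    with _ , s′ , refl ← φ-[]=⁻ s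
    with fill-flat⇒⊑ p s′ (proj₁ (entry-range s′)) u≤1
  ... | inj₁ 0<0         = contradiction 0<0 (ℤ.<-irrefl refl)
  ... | inj₂ (_ , j₁≤j₀) = j₁≤j₀

  idx-statistic : idx₁ 𝒯 ≡ idx₁ 𝔗
  idx-statistic
    with (j₁ , r , c) , p ← cell-of ℕ.≤-refl 1≤ℓ
    with refl ← one-in-corner p
    with j₀ , _ , found , j₀≤j₁ ← locate-complete (φ-[]=⁺ p)
    with _ , _ , _ , q ← locate-sound {𝒯 = 𝔗} found
    rewrite locate-cell p | found | ℕ.≤-antisym j₀≤j₁ (component-of-one p q) = refl

-- Standardisation

Key : Set
Key = ℕ × ℤ × ℕ

_≺_ : Rel Key 0ℓ
_≺_ = ×-Lex _≡_ _<_ _⊏_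

≺-isStrictTotalOrder : IsStrictTotalOrder _≡_ _≺_
≺-isStrictTotalOrder = ×-Lex-isStrictTotalOrder ℕ.<-isStrictTotalOrder ⊏-isStrictTotalOrder

open Rank ≺-isStrictTotalOrder
open IsStrictTotalOrder ≺-isStrictTotalOrder using () renaming (_<?_ to _≺?_; irrefl to ≺-irrefl; asym to ≺-asym)

key : Cell × ℕ → Key
key (x , v) = v , locus x

keys : ∀ {k} → Vec Tableau k → List Key
keys 𝔗 = map key (cells 𝔗)

standardise : ∀ {k} → Vec Tableau k → Vec Tableau k
standardise 𝔗 = relabel (λ x v → rank (keys 𝔗) (key (x , v))) 𝔗

module Standardisation {k} {Λ : Vec Partition k} {𝔗 : Vec Tableau k} (𝔗-ssyt : IsSSYTTuple Λ 𝔗) where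
  open SSYT 𝔗-ssyt

  dominates : ∀ {j r c r′ c′ v w} → 𝔗 [ j , r , c ]= v → 𝔗 [ j , r′ , c′ ]= w → r < r′ → c ≤ c′ → v < w
  dominates p q r<r′ c≤c′
    with u , s , u≤w ← left-≤ rows↑ (ℕ.≤⇒≤′ c≤c′) q with v′ , t , v′<u ← above-< columns r<r′ s
    rewrite []=-functional p t = ℕ.<-≤-trans v′<u u≤w

  -- two cells with the same entry and the same content lie on a diagonal, along which entries increase strictly
  same-locus⇒same-cell : ∀ {x y v} → 𝔗 [ x ]= v → 𝔗 [ y ]= v → locus x ≡ locus y → x ≡ y
  same-locus⇒same-cell {j , r , c} {j′ , r′ , c′} p q eq
    with refl ← ,-injectiveʳ eq with diagonal ← content-≡⇒ {j} {r} {c} {j′} {r′} {c′} (,-injectiveˡ eq) with ℕ.<-cmp r r′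
  ... | tri< r<r′ _ _ = contradiction (dominates p q r<r′ (ℕ.<⇒≤ (ℕ.+-cancelʳ-< r′ c c′
                          (subst (_< c′ + r′) (sym diagonal) (ℕ.+-monoʳ-< c′ r<r′))))) (ℕ.<-irrefl refl)
  ... | tri≈ _ refl _ = cong (λ c → j , r , c) (ℕ.+-cancelʳ-≡ r c c′ diagonal)
  ... | tri> _ _ r′<r = contradiction (dominates q p r′<r (ℕ.<⇒≤ (ℕ.+-cancelʳ-< r c′ c
                          (subst (_< c + r) diagonal (ℕ.+-monoʳ-< c r′<r))))) (ℕ.<-irrefl refl)

  keys-unique : Unique (keys 𝔗)
  keys-unique = Unique-map⁺-∈ same-key (cells-unique 𝔗)
    where
    same-key : ∀ {a b} → a ∈ cells 𝔗 → b ∈ cells 𝔗 → key a ≡ key b → a ≡ b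
    same-key {x , v} {y , w} a∈ b∈ eq with refl ← ,-injectiveˡ eq =
      cong (_, v) (same-locus⇒same-cell (∈cells⁻ a∈) (∈cells⁻ b∈) (,-injectiveʳ eq))

  private
    𝒮 : Vec Tableau k
    𝒮 = standardise 𝔗
    ρ : Cell → ℕ → ℕ
    ρ x v = rank (keys 𝔗) (key (x , v))

  ρ-rows : Increases _<_ right ρ 𝔗
  ρ-rows {x} {v} {w} p q = rank-mono (∈.∈-map⁺ key (∈cells⁺ p)) key≺
    where
    key≺ : key (x , v) ≺ key (right x , w)
    key≺ with ℕ.m≤n⇒m<n∨m≡n (rows↑ p q)
    ... | inj₁ v<w = inj₁ v<w
    ... | inj₂ v≡w = inj₂ (v≡w , inj₁ (content-right {x}))

  ρ-columns : Increases _<_ below ρ 𝔗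
  ρ-columns p q = rank-mono (∈.∈-map⁺ key (∈cells⁺ p)) (inj₁ (columns↑ p q))

  standardise-syt : IsSYTTuple Λ 𝒮
  standardise-syt = trans (shape-relabel ρ 𝔗) (proj₁ 𝔗-ssyt)
                  , VAll.zip (relabel-rows rowStrict ρ-rows , relabel-columns columns ρ-columns)
                  , entries-↭
    where
    open PermutationReasoning
    entries-↭ : flatten 𝒮 ↭ oneTo (totalSize Λ)
    entries-↭ = begin
      flatten 𝒮                            ≡⟨ flatten-relabel 𝔗 ρ ⟩
      map (rank (keys 𝔗) ∘ key) (cells 𝔗)  ≡⟨ List.map-∘ (cells 𝔗) ⟩
      map (rank (keys 𝔗)) (keys 𝔗)         ↭⟨ ranks-↭ (length (keys 𝔗)) refl keys-unique ⟩
      oneTo (length (keys 𝔗))              ≡⟨ cong oneTo length-keys ⟩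
      oneTo (totalSize Λ)                  ∎
      where
      length-keys : length (keys 𝔗) ≡ totalSize Λ
      length-keys = trans (List.length-map key (cells 𝔗)) (trans (sym (List.length-map proj₂ (cells 𝔗)))
                      (trans (cong length (entries-cells 𝔗)) (trans (length-flatten 𝔗) (cong totalSize (proj₁ 𝔗-ssyt)))))

module Surjectivity {k} {Λ : Vec Partition k} {𝔗 : Vec Tableau k} (𝔗-ssyt : IsSSYTTuple Λ 𝔗) (1≤ℓ : 1 ≤ totalSize Λ) where
  open Standardisation 𝔗-ssyt

  private
    𝒮 : Vec Tableau k
    𝒮 = standardise 𝔗
    module 𝒮 = SYT standardise-syt

  entryOfRank : ℕ → ℕ
  entryOfRank s = maybe proj₁ 0 (unrank (keys 𝔗) s)

  entryOfRank-at : ∀ {x v s} → 𝔗 [ x ]= v → rank (keys 𝔗) (key (x , v)) ≡ s → entryOfRank s ≡ v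
  entryOfRank-at p refl = cong (maybe proj₁ 0) (unrank-rank (∈.∈-map⁺ key (∈cells⁺ p)))

  cell-of-rank : ∀ {s} → 1 ≤ s → s ≤ totalSize Λ → ∃[ x ] ∃[ v ] 𝔗 [ x ]= v × rank (keys 𝔗) (key (x , v)) ≡ s
  cell-of-rank 1≤s s≤ℓ with x , p ← 𝒮.cell-of 1≤s s≤ℓ with v , q , s≡ ← relabel-[]=⁻ p = x , v , q , sym s≡

  -- the cell of rank 1 carries the least entry of 𝔗, which is 1
  rank-one⇒entry-one : ∀ {x u} → 𝔗 [ x ]= u → rank (keys 𝔗) (key (x , u)) ≡ 1 → u ≡ 1
  rank-one⇒entry-one {x} {u} p rank≡1 = ℕ.≤-antisym u≤1 (All.lookup (proj₁ (proj₂ (proj₂ 𝔗-ssyt))) ([]=⇒∈flatten p))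
    where
    u≤1 : u ≤ 1
    u≤1 with u ℕ.≤? 1
    ... | yes u≤1 = u≤1
    ... | no u≰1  = let y , q = ∈flatten⇒[]= 𝔗 (proj₂ (proj₂ (proj₂ 𝔗-ssyt))) in
      contradiction (subst (rank (keys 𝔗) (key (y , 1)) <_) rank≡1 (rank-mono (∈.∈-map⁺ key (∈cells⁺ q)) (inj₁ (ℕ.≰⇒> u≰1))))
                    (ℕ.≤⇒≯ (s≤s z≤n))

  entryOfRank-one : entryOfRank 1 ≡ 1
  entryOfRank-one = let _ , _ , p , rank≡1 = cell-of-rank ℕ.≤-refl 1≤ℓ in
    trans (entryOfRank-at p rank≡1) (rank-one⇒entry-one p rank≡1)

  consecutive-ranks : ∀ {x y v w s} → 𝔗 [ x ]= v → 𝔗 [ y ]= w →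
    rank (keys 𝔗) (key (x , v)) ≡ s → rank (keys 𝔗) (key (y , w)) ≡ suc s → v < w ⊎ (v ≡ w × isDescent 𝒮 s ≡ false)
  consecutive-ranks p q rank-x rank-y =
    Sum.map₂ (λ (v≡w , x⊏y) → v≡w , ⊏⇒nonDescent 𝒮 (locate-rank p rank-x) (locate-rank q rank-y) x⊏y)
             (rank-cancel-≺ (∈.∈-map⁺ key (∈cells⁺ q)) (subst₂ _<_ (sym rank-x) (sym rank-y) (ℕ.n<1+n _)))
    where
    locate-rank : ∀ {x v s} → 𝔗 [ x ]= v → rank (keys 𝔗) (key (x , v)) ≡ s → locate 𝒮 s ≡ just (proj₁ x , content x)
    locate-rank p refl = 𝒮.locate-cell (relabel-[]=⁺ p)

  entryOfRank-step : ∀ {s} → 1 ≤ s → suc s ≤ totalSize Λ → entryOfRank s + descentAt 𝒮 s ≤ entryOfRank (suc s)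
  entryOfRank-step {s} 1≤s s<ℓ =
    let x , v , p , rank-x = cell-of-rank 1≤s (ℕ.<⇒≤ s<ℓ)
        y , w , q , rank-y = cell-of-rank (s≤s z≤n) s<ℓ
    in subst₂ (λ a b → a + descentAt 𝒮 s ≤ b) (sym (entryOfRank-at p rank-x)) (sym (entryOfRank-at q rank-y))
              (bound (consecutive-ranks p q rank-x rank-y))
    where
    bound : ∀ {v w} → v < w ⊎ (v ≡ w × isDescent 𝒮 s ≡ false) → v + descentAt 𝒮 s ≤ w
    bound {v} {w} (inj₁ v<w)      = ℕ.≤-trans (ℕ.+-monoʳ-≤ v (descentAt-≤1 𝒮 s)) (subst (_≤ w) (ℕ.+-comm 1 v) v<w)
    bound {v} (inj₂ (refl , nd)) = ℕ.≤-reflexive (trans (cong (λ d → v + d) (descentAt-false 𝒮 nd)) (ℕ.+-identityʳ v))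

  open Interpolation 𝒮 entryOfRank (totalSize Λ) entryOfRank-one entryOfRank-step public using (interpolant)

  φ-standardise : φ interpolant 𝒮 ≡ 𝔗
  φ-standardise = tuple-≡ (trans (proj₁ (Phi.φ-ssyt standardise-syt interpolant 1≤ℓ)) (sym (proj₁ 𝔗-ssyt))) (begin
    flatten (φ interpolant 𝒮)                                     ≡⟨ flatten-mapEntries f 𝒮 ⟩
    map f (flatten 𝒮)                                             ≡⟨ cong (map f) (flatten-relabel 𝔗 _) ⟩
    map f (map (rank (keys 𝔗) ∘ key) (cells 𝔗))                    ≡⟨ List.map-∘ (cells 𝔗) ⟨
    map (f ∘ rank (keys 𝔗) ∘ key) (cells 𝔗)                        ≡⟨ List.map-cong-local (All.tabulate f-rank) ⟩
    map proj₂ (cells 𝔗)                                           ≡⟨ entries-cells 𝔗 ⟩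
    flatten 𝔗                                                     ∎)
    where
    open ≡-Reasoning
    f : ℕ → ℕ
    f = fill interpolant 𝒮
    f-rank : ∀ {a} → a ∈ cells 𝔗 → f (rank (keys 𝔗) (key a)) ≡ proj₂ a
    f-rank a∈ = let p = ∈cells⁻ a∈ in
      trans (Interpolation.fill-interpolant 𝒮 entryOfRank (totalSize Λ) entryOfRank-one entryOfRank-step
               (s≤s z≤n) (proj₂ (𝒮.entry-range (relabel-[]=⁺ p))))
            (entryOfRank-at p refl)

module Injectivity {k} {Λ : Vec Partition k} {𝒯 : Vec Tableau k} (𝒯-syt : IsSYTTuple Λ 𝒯)
  (1≤ℓ : 1 ≤ totalSize Λ) {n} (α : Vec ℕ n) where
  open SYT 𝒯-syt
  open Phi 𝒯-syt α
  open Standardisation (φ-ssyt 1≤ℓ) using (same-locus⇒same-cell)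

  private
    f : ℕ → ℕ
    f = fill α 𝒯
    𝔗 : Vec Tableau k
    𝔗 = φ α 𝒯

  keys-φ : keys 𝔗 ≡ map (λ (y , w) → f w , locus y) (cells 𝒯)
  keys-φ = trans (cong (map key) (trans (cong cells φ≡relabel) (cells-relabel 𝒯 (λ _ → f)))) (sym (List.map-∘ (cells 𝒯)))

  ≺⇐< : ∀ {x y v w} → 𝒯 [ y ]= w → 𝒯 [ x ]= v → w < v → (f w , locus y) ≺ (f v , locus x)
  ≺⇐< {x} {y} {v} {w} q p w<v = [ inj₁ , equal ]′ (ℕ.m≤n⇒m<n∨m≡n (fill-mono α 𝒯 (ℕ.<⇒≤ w<v)))
    where
    distinct : f w ≡ f v → locus y ≢ locus x
    distinct fw≡fv eq = ℕ.<-irrefl (cong-entry (same-locus⇒same-cell (subst (𝔗 [ y ]=_) fw≡fv (φ-[]=⁺ q)) (φ-[]=⁺ p) eq)) w<v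
      where
      cong-entry : y ≡ x → w ≡ v
      cong-entry refl = []=-functional q p
    equal : f w ≡ f v → (f w , locus y) ≺ (f v , locus x)
    equal fw≡fv = inj₂ (fw≡fv , ⊑∧≢⇒⊏ (fill-flat⇒⊑ q p (ℕ.<⇒≤ w<v) (ℕ.≤-reflexive (sym fw≡fv))) (distinct fw≡fv))

  ≺⇒< : ∀ {x y v w} → 𝒯 [ y ]= w → 𝒯 [ x ]= v → (f w , locus y) ≺ (f v , locus x) → w < v
  ≺⇒< {x} {y} {v} {w} q p y≺x with ℕ.<-cmp w v
  ... | tri< w<v _ _ = w<v
  ... | tri≈ _ refl _ = contradiction (subst (λ z → (f w , locus z) ≺ (f v , locus x)) (cell-unique q p) y≺x) (≺-irrefl refl)
  ... | tri> _ _ v<w = contradiction (≺⇐< p q v<w) (≺-asym y≺x)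

  rank-φ : ∀ {x v} → 𝒯 [ x ]= v → rank (keys 𝔗) (f v , locus x) ≡ v
  rank-φ {x} {v} p = begin
    suc (count (_≺? κ) (keys 𝔗))                                    ≡⟨ cong (suc ∘ count (_≺? κ)) keys-φ ⟩
    suc (count (_≺? κ) (map (λ (y , w) → f w , locus y) (cells 𝒯))) ≡⟨ cong suc (count-map (_≺? κ) _ (cells 𝒯)) ⟩
    suc (count (λ (y , w) → (f w , locus y) ≺? κ) (cells 𝒯))
      ≡⟨ cong suc (count-cong _ ((ℕ._<? v) ∘ proj₂) (λ a∈ → ≺⇒< (∈cells⁻ a∈) p) (λ a∈ → ≺⇐< (∈cells⁻ a∈) p)) ⟩
    suc (count ((ℕ._<? v) ∘ proj₂) (cells 𝒯))                        ≡⟨ cong suc (count-map (ℕ._<? v) proj₂ (cells 𝒯)) ⟨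
    suc (count (ℕ._<? v) (map proj₂ (cells 𝒯)))                      ≡⟨ cong suc (count-<-↭oneTo values-↭ (proj₂ (entry-range p))) ⟩
    suc (v ∸ 1)                                                      ≡⟨ ℕ.suc-pred v {{>-nonZero (proj₁ (entry-range p))}} ⟩
    v                                                                ∎
    where
    open ≡-Reasoning
    κ : Key
    κ = f v , locus x

  standardise-φ : standardise 𝔗 ≡ 𝒯
  standardise-φ = tuple-≡ (trans (shape-relabel _ 𝔗) (trans (proj₁ (φ-ssyt 1≤ℓ)) (sym (proj₁ 𝒯-syt)))) (begin
    flatten (standardise 𝔗)                                         ≡⟨ flatten-relabel 𝔗 _ ⟩
    map (rank (keys 𝔗) ∘ key) (cells 𝔗)
      ≡⟨ cong (map (rank (keys 𝔗) ∘ key)) (trans (cong cells φ≡relabel) (cells-relabel 𝒯 (λ _ → f))) ⟩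
    map (rank (keys 𝔗) ∘ key) (map (λ (y , w) → y , f w) (cells 𝒯)) ≡⟨ List.map-∘ (cells 𝒯) ⟨
    map (λ (y , w) → rank (keys 𝔗) (f w , locus y)) (cells 𝒯)        ≡⟨ List.map-cong-local (All.tabulate (rank-φ ∘ ∈cells⁻)) ⟩
    map proj₂ (cells 𝒯)                                             ≡⟨ entries-cells 𝒯 ⟩
    flatten 𝒯                                                       ∎)
    where open ≡-Reasoning

φ-injectiveˡ : ∀ {k} {Λ : Vec Partition k} {𝒯 : Vec Tableau k} → IsSYTTuple Λ 𝒯 → 1 ≤ totalSize Λ →
               ∀ {α α′ : Vec ℕ (totalSize Λ ∸ 1)} → φ α 𝒯 ≡ φ α′ 𝒯 → α ≡ α′
φ-injectiveˡ {Λ = Λ} {𝒯} 𝒯-syt 1≤ℓ {α} {α′} eq = fill-injectiveˡ 𝒯 same-fill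
  where
  open SYT 𝒯-syt using (cell-of)
  same-fill : ∀ {m} → m ≤ totalSize Λ ∸ 1 → fill α 𝒯 (suc m) ≡ fill α′ 𝒯 (suc m)
  same-fill {m} m≤ =
    let x , p = cell-of (s≤s z≤n) (subst (suc m ≤_) (ℕ.suc-pred (totalSize Λ) {{>-nonZero 1≤ℓ}}) (s≤s m≤))
    in []=-functional (subst (_[ x ]= fill α 𝒯 (suc m)) eq (Phi.φ-[]=⁺ 𝒯-syt α p)) (Phi.φ-[]=⁺ 𝒯-syt α′ p)

proposition5p2 : ∀ (k : ℕ) (Λ : Vec Partition k) →
    VAll.All IsPartition Λ → 1 ≤ totalSize Λ →
    (∀ (α : Vec ℕ (totalSize Λ ∸ 1)) (𝒯 : Vec Tableau k) →
       IsSYTTuple Λ 𝒯 → IsSSYTTuple Λ (φ α 𝒯))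
    × (∀ (α α′ : Vec ℕ (totalSize Λ ∸ 1)) (𝒯 𝒯′ : Vec Tableau k) →
         IsSYTTuple Λ 𝒯 → IsSYTTuple Λ 𝒯′ → φ α 𝒯 ≡ φ α′ 𝒯′ →
         α ≡ α′ × 𝒯 ≡ 𝒯′)
    × (∀ (𝔗 : Vec Tableau k) → IsSSYTTuple Λ 𝔗 →
         Σ (Vec ℕ (totalSize Λ ∸ 1)) λ α → Σ (Vec Tableau k) λ 𝒯 →
           IsSYTTuple Λ 𝒯 × φ α 𝒯 ≡ 𝔗)
    × (∀ (α : Vec ℕ (totalSize Λ ∸ 1)) (𝒯 𝔗 : Vec Tableau k) →
         IsSYTTuple Λ 𝒯 → φ α 𝒯 ≡ 𝔗 →
         (∣ α ∣ + length (DES Λ 𝒯) + 1 ≡ maxEntry 𝔗)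
         × (idx₁ 𝒯 ≡ idx₁ 𝔗))
proposition5p2 k Λ _ 1≤ℓ = well-defined , injective , surjective , statistics
  where
  well-defined : ∀ α 𝒯 → IsSYTTuple Λ 𝒯 → IsSSYTTuple Λ (φ α 𝒯)
  well-defined α 𝒯 𝒯-syt = Phi.φ-ssyt 𝒯-syt α 1≤ℓ

  injective : ∀ α α′ 𝒯 𝒯′ → IsSYTTuple Λ 𝒯 → IsSYTTuple Λ 𝒯′ → φ α 𝒯 ≡ φ α′ 𝒯′ →
              α ≡ α′ × 𝒯 ≡ 𝒯′
  injective α α′ 𝒯 𝒯′ 𝒯-syt 𝒯′-syt eq
    with refl ← trans (sym (Injectivity.standardise-φ 𝒯-syt 1≤ℓ α))
                      (trans (cong standardise eq) (Injectivity.standardise-φ 𝒯′-syt 1≤ℓ α′))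
    = φ-injectiveˡ 𝒯-syt 1≤ℓ eq , refl

  surjective : ∀ 𝔗 → IsSSYTTuple Λ 𝔗 →
               Σ (Vec ℕ (totalSize Λ ∸ 1)) λ α → Σ (Vec Tableau k) λ 𝒯 → IsSYTTuple Λ 𝒯 × φ α 𝒯 ≡ 𝔗
  surjective 𝔗 𝔗-ssyt = let open Surjectivity 𝔗-ssyt 1≤ℓ in
    interpolant , standardise 𝔗 , Standardisation.standardise-syt 𝔗-ssyt , φ-standardise

  statistics : ∀ α 𝒯 𝔗 → IsSYTTuple Λ 𝒯 → φ α 𝒯 ≡ 𝔗 →
               (∣ α ∣ + length (DES Λ 𝒯) + 1 ≡ maxEntry 𝔗) × (idx₁ 𝒯 ≡ idx₁ 𝔗)
  statistics α 𝒯 _ 𝒯-syt refl = let open Statistics 𝒯-syt 1≤ℓ α in max-statistic , idx-statistic
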